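{- Let $p>q\geq 1$ be integers and let $\beta$ be the larger root of $x^2-(p+1)x+(p-q)=0$. If $x,y\in\mathbb Z_\beta$ with $x\geq y\geq 0$, then either $x-y\in\mathbb Z_\beta$ or $x-y\notin Fin(\beta)$.
   Context: For $\beta>1$, the $\beta$-expansion of $x>0$ is the greedy representation $x=\sum_{i\le k}x_i\beta^i$. $\mathbb Z_\beta$ consists of $0$ and the reals $\pm x$ with $x>0$ whose $\beta$-expansion has $x_i=0$ for all $i<0$. $Fin(\beta)=\bigcup_{n\in\mathbb N}\beta^{ -n}\mathbb Z_\beta$ is the set of reals whose absolute value has a finite $\beta$-expansion. -}

module Defs where

open import Data.Nat as ℕ using (ℕ; zero; suc)
open import Data.Integer as ℤ using (ℤ; +_; 0ℤ; 1ℤ)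
open import Data.Product using (_×_; _,_; ∃₂)
open import Data.Sum using (_⊎_)
open import Data.List using (List; []; _∷_; take; length; _∷ʳ_)
open import Relation.Binary.PropositionalEquality using (_≡_; _≢_)

-- Every element of ℤ_β (and every difference of
-- two such elements) lies in the ring ℤ[β] = { a + b β | a b ∈ ℤ },
-- since β is an algebraic integer.  We represent a + b β by the pair (a , b).
-- For q < p, D = (p-1)² + 4q is not a perfect square, so β is irrational and
-- the representation is unique: equality of reals = equality of pairs.

Zβ : Set
Zβ = ℤ × ℤ

ι : ℤ → Zβ
ι a = a , 0ℤ

𝟘 : Zβ
𝟘 = ι 0ℤ

_⊕_ : Zβ → Zβ → Zβ
(a , b) ⊕ (c , d) = a ℤ.+ c , b ℤ.+ d

⊝_ : Zβ → Zβ
⊝ (a , b) = ℤ.- a , ℤ.- b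

_⊖_ : Zβ → Zβ → Zβ
x ⊖ y = x ⊕ (⊝ y)

-- multiplication by β, using β² = (p+1) β - (p-q)
βmul : ℕ → ℕ → Zβ → Zβ
βmul p q (a , b) = ℤ.- (b ℤ.* (+ p ℤ.- + q)) , a ℤ.+ b ℤ.* + (suc p)

βpow : ℕ → ℕ → ℕ → Zβ
βpow p q zero    = ι 1ℤ
βpow p q (suc n) = βmul p q (βpow p q n)

βpowMul : ℕ → ℕ → ℕ → Zβ → Zβ
βpowMul p q zero    z = z
βpowMul p q (suc n) z = βmul p q (βpowMul p q n z)

-- discriminant D = (p+1)² - 4(p-q), so that 2β = (p+1) + √D
disc : ℕ → ℕ → ℤ
disc p q = + (suc p) ℤ.* + (suc p) ℤ.- + 4 ℤ.* (+ p ℤ.- + q)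

-- a + b β > 0  (as a real number)  ⇔  c + b √D > 0 where c = 2a + b(p+1)
Pos : ℕ → ℕ → Zβ → Set
Pos p q (a , b) =
  (0ℤ ℤ.≤ c × 0ℤ ℤ.≤ b × (0ℤ ℤ.< c ⊎ 0ℤ ℤ.< b))
  ⊎ (0ℤ ℤ.< c × b ℤ.< 0ℤ × b ℤ.* b ℤ.* disc p q ℤ.< c ℤ.* c)
  ⊎ (c ℤ.< 0ℤ × 0ℤ ℤ.< b × c ℤ.* c ℤ.< b ℤ.* b ℤ.* disc p q)
  where c = + 2 ℤ.* a ℤ.+ b ℤ.* + (suc p)

_<[_,_]_ : Zβ → ℕ → ℕ → Zβ → Set
x <[ p , q ] y = Pos p q (y ⊖ x)

_≤[_,_]_ : Zβ → ℕ → ℕ → Zβ → Set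
x ≤[ p , q ] y = x <[ p , q ] y ⊎ x ≡ y

-- value of a little-endian digit list d₀ d₁ … d_k :  Σ dᵢ βⁱ  (Horner)
val : ℕ → ℕ → List ℕ → Zβ
val p q []       = 𝟘
val p q (d ∷ ds) = ι (+ d) ⊕ βmul p q (val p q ds)

-- ds = d₀ … d_k is the (greedy) β-expansion of z > 0, and it has no
-- digits at negative positions:  z = Σ_{i≤k} dᵢ βⁱ, d_k ≠ 0, and the
-- greedy condition  Σ_{i<j} dᵢ βⁱ < β^j  for every 0 ≤ j ≤ k+1
-- (which says exactly that every digit was chosen maximal; for j = k+1
-- it says β^k ≤ z < β^{k+1}, fixing the leading position k, and for
-- j = 0 it says the part at negative positions, namely 0, is < 1).
IsIntExpansion : ℕ → ℕ → Zβ → List ℕ → Set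
IsIntExpansion p q z ds =
  val p q ds ≡ z
  × (∃₂ λ (init : List ℕ) (d : ℕ) → ds ≡ init ∷ʳ d × d ≢ 0)
  × (∀ (j : ℕ) → j ℕ.≤ length ds → val p q (take j ds) <[ p , q ] βpow p q j)

Inℤβ : ℕ → ℕ → Zβ → Set
Inℤβ p q z =
  z ≡ 𝟘
  ⊎ (Pos p q z × (∃ λ ds → IsIntExpansion p q z ds))
  ⊎ (Pos p q (⊝ z) × (∃ λ ds → IsIntExpansion p q (⊝ z) ds))
  where open import Data.Product using (∃)

-- z ∈ Fin(β) = ⋃ₙ β^{-n} ℤ_β   ⇔   ∃ n, βⁿ z ∈ ℤ_β
InFin : ℕ → ℕ → Zβ → Set
InFin p q z = ∃ λ (n : ℕ) → Inℤβ p q (βpowMul p q n z)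
  where open import Data.Product using (∃)

module Submission where

-- Write z ∈ ℤ[β] as z = rank z − defect z · (p + 1 − β).  The elements of ℤβ ∩ [0, ∞) are the
-- values of the digit strings satisfying Parry's condition for β (whose quasi-greedy expansion of
-- 1 is p q q q …), and when these strings are enumerated by the odometer, the n-th one has rank n
-- and defect C n, where C n counts the m < n whose string ends in the "tight" state of the
-- automaton recognising the condition.  C is superadditive.  Now let x > y be in ℤβ and let
-- d be the lowest digit of an admissible string for β (x − y).  Comparing coordinates,
-- d = (p − q) (C w + C y′ − C x′) where x′ = y′ + w are the indices involved, so d ≤ 0: the digit
-- vanishes and x − y is admissible itself.  By induction, βⁿ (x − y) ∈ ℤβ forces x − y ∈ ℤβ.
-- Finally an admissible value is determined by its rank, so it is decidable whether x − y is one: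
-- either x − y ∈ ℤβ, or x − y ∉ Fin(β).

open import Defs
open import Data.Nat using (ℕ; _≤_; _<_; zero; suc; pred; _+_; _*_; _∸_; z≤n; s≤s; _≤′_; ≤′-refl; ≤′-step; >-nonZero; _≟_; _<?_; _≤?_)
open import Data.Nat.Induction using (<-rec)
import Data.Nat.Properties as ℕP
open import Data.Nat.Tactic.RingSolver using () renaming (solve-∀ to solveℕ-∀)
open import Data.Integer as ℤ using (ℤ; +_; +0; -[1+_]; +[1+_]; 0ℤ; 1ℤ; +≤+; +<+; -<+)
import Data.Integer.Properties as ℤP
open import Data.Integer.Tactic.RingSolver using (solve-∀)
open import Algebra.Properties.AbelianGroup ℤP.+-0-abelianGroup using () renaming (∙-cancelʳ to ℤ+-cancelʳ)
open import Data.List using (List; []; _∷_; _++_; _∷ʳ_; take; length; replicate)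
open import Data.List.Properties using (++-assoc; length-++; length-take; ∷-injectiveʳ)
open import Data.Product using (_×_; _,_; proj₁; proj₂; ∃; ∃₂)
open import Data.Product.Properties using (≡-dec)
open import Data.Sum as Sum using (_⊎_; inj₁; inj₂)
open import Data.Unit using (⊤; tt)
open import Data.Empty using (⊥; ⊥-elim)
open import Function using (_∘_)
open import Relation.Nullary using (¬_; Dec; yes; no)
open import Relation.Nullary.Decidable using (toSum)
open import Relation.Binary.PropositionalEquality

≤-stepwise-mono : ∀ (f : ℕ → ℕ) → (∀ n → f n ≤ f (suc n)) → ∀ {m n} → m ≤ n → f m ≤ f n
≤-stepwise-mono f step m≤n = go (ℕP.≤⇒≤′ m≤n)
  where
  go : ∀ {m n} → m ≤′ n → f m ≤ f n
  go ≤′-refl = ℕP.≤-refl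
  go (≤′-step m≤′n) = ℕP.≤-trans (go m≤′n) (step _)

take-++-length : ∀ {A : Set} (xs ys zs : List A) → take (length xs + length ys) (xs ++ ys ++ zs) ≡ xs ++ ys
take-++-length (x ∷ xs) ys zs = cong (x ∷_) (take-++-length xs ys zs)
take-++-length [] [] zs = refl
take-++-length [] (y ∷ ys) zs = cong (y ∷_) (take-++-length [] ys zs)

length-++-prefix : ∀ {A : Set} (xs ys zs : List A) → length xs + length ys ≤ length (xs ++ ys ++ zs)
length-++-prefix xs ys zs = begin
  length xs + length ys                   ≤⟨ ℕP.+-monoʳ-≤ (length xs) (ℕP.m≤m+n (length ys) (length zs)) ⟩
  length xs + (length ys + length zs)     ≡⟨ cong (λ n → length xs + n) (length-++ ys) ⟨
  length xs + length (ys ++ zs)           ≡⟨ length-++ xs ⟨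
  length (xs ++ ys ++ zs)                 ∎
  where open ℕP.≤-Reasoning

⊕-assoc : ∀ u v w → (u ⊕ v) ⊕ w ≡ u ⊕ (v ⊕ w)
⊕-assoc (a , b) (c , d) (e , f) = cong₂ _,_ (ℤP.+-assoc a c e) (ℤP.+-assoc b d f)

⊕-identityˡ : ∀ u → 𝟘 ⊕ u ≡ u
⊕-identityˡ (a , b) = cong₂ _,_ (ℤP.+-identityˡ a) (ℤP.+-identityˡ b)

⊖-self : ∀ u → u ⊖ u ≡ 𝟘
⊖-self (a , b) = cong₂ _,_ (ℤP.+-inverseʳ a) (ℤP.+-inverseʳ b)

⊝-involutive : ∀ u → ⊝ (⊝ u) ≡ u
⊝-involutive (a , b) = cong₂ _,_ (ℤP.neg-involutive a) (ℤP.neg-involutive b)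

⊝-⊖ : ∀ u v → ⊝ (u ⊖ v) ≡ v ⊖ u
⊝-⊖ (a , b) (c , d) = cong₂ _,_ (law a c) (law b d)
  where
  law : ∀ x y → ℤ.- (x ℤ.+ ℤ.- y) ≡ y ℤ.+ ℤ.- x
  law = solve-∀

⊝-⊕ : ∀ u v → (⊝ u) ⊖ v ≡ ⊝ (u ⊕ v)
⊝-⊕ (a , b) (c , d) = cong₂ _,_ (law a c) (law b d)
  where
  law : ∀ x y → ℤ.- x ℤ.+ ℤ.- y ≡ ℤ.- (x ℤ.+ y)
  law = solve-∀

⊖-⊕-cancel : ∀ u v → (u ⊖ v) ⊕ v ≡ u
⊖-⊕-cancel (a , b) (c , d) = cong₂ _,_ (law a c) (law b d)
  where
  law : ∀ x y → (x ℤ.+ ℤ.- y) ℤ.+ y ≡ x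
  law = solve-∀

⊖-⊕-distrib : ∀ u v w → u ⊖ (v ⊕ w) ≡ ⊝ (v ⊕ (w ⊖ u))
⊖-⊕-distrib (a , b) (c , d) (e , f) = cong₂ _,_ (law a c e) (law b d f)
  where
  law : ∀ x y z → x ℤ.+ ℤ.- (y ℤ.+ z) ≡ ℤ.- (y ℤ.+ (z ℤ.+ ℤ.- x))
  law = solve-∀

-- c + b √D > 0 for a non-square D > 0; Pos p q (a , b) is SurdPos (disc p q) (2a + b(p + 1)) b,
-- as 2β = p + 1 + √(disc p q)
SurdPos : ℤ → ℤ → ℤ → Set
SurdPos D c b =
  (0ℤ ℤ.≤ c × 0ℤ ℤ.≤ b × (0ℤ ℤ.< c ⊎ 0ℤ ℤ.< b))
  ⊎ (0ℤ ℤ.< c × b ℤ.< 0ℤ × b ℤ.* b ℤ.* D ℤ.< c ℤ.* c)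
  ⊎ (c ℤ.< 0ℤ × 0ℤ ℤ.< b × c ℤ.* c ℤ.< b ℤ.* b ℤ.* D)

data Minus (m n : ℕ) : ℤ → Set where
  nonneg : ∀ k → m ≡ n + k → Minus m n (+ k)
  neg    : ∀ k → n ≡ m + suc k → Minus m n -[1+ k ]

minus : ∀ m n → Minus m n (+ m ℤ.- + n)
minus m n with ℕP.≤-<-connex n m
... | inj₁ n≤m = subst (Minus m n) (sym (trans (ℤP.m-n≡m⊖n m n) (ℤP.⊖-≥ n≤m)))
                   (nonneg (m ∸ n) (sym (ℕP.m+[n∸m]≡n n≤m)))
... | inj₂ m<n with ℕP.m≤n⇒∃[o]m+o≡n m<n
...   | k , refl = subst (Minus m n) (sym (trans (ℤP.m-n≡m⊖n m n) (ℤP.⊖-< m<n)))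
                     (subst (λ i → Minus m n (ℤ.- + i)) (sym n∸m≡1+k) (neg k (sym (ℕP.+-suc m k))))
  where
  n∸m≡1+k : suc (m + k) ∸ m ≡ suc k
  n∸m≡1+k = trans (cong (_∸ m) (sym (ℕP.+-suc m k))) (ℕP.m+n∸m≡n m (suc k))

+t*+t*+D : ∀ t D → + t ℤ.* + t ℤ.* + D ≡ + (t * t * D)
+t*+t*+D t D = sym (trans (ℤP.pos-* (t * t) D) (cong (ℤ._* + D) (ℤP.pos-* t t)))

square-≤ : ∀ {a D} t m → a ≤ t * m → m * m ≤ D → a * a ≤ t * t * D
square-≤ {a} {D} t m a≤tm m²≤D = begin
  a * a             ≤⟨ ℕP.*-mono-≤ a≤tm a≤tm ⟩
  (t * m) * (t * m) ≡⟨ ℕP.[m*n]*[o*p]≡[m*o]*[n*p] t m t m ⟩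
  t * t * (m * m)   ≤⟨ ℕP.*-monoʳ-≤ (t * t) m²≤D ⟩
  t * t * D         ∎
  where open ℕP.≤-Reasoning

square-< : ∀ {a D} t m → a ≤ suc t * m → m * m < D → a * a < suc t * suc t * D
square-< {a} {D} t m a≤tm m²<D = begin-strict
  a * a                     ≤⟨ ℕP.*-mono-≤ a≤tm a≤tm ⟩
  (suc t * m) * (suc t * m) ≡⟨ ℕP.[m*n]*[o*p]≡[m*o]*[n*p] (suc t) m (suc t) m ⟩
  suc t * suc t * (m * m)   <⟨ ℕP.*-monoʳ-< (suc t * suc t) m²<D ⟩
  suc t * suc t * D         ∎
  where open ℕP.≤-Reasoning

-- c + t√D = 2s + t(√D − m) with m < √D
surdPos-cone : ∀ {D c} s t m → m * m < D → 1 ≤ s + t → Minus (2 * s) (t * m) c → SurdPos (+ D) c (+ t)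
surdPos-cone s (suc t) m _ _ (nonneg k _) = inj₁ (+≤+ z≤n , +≤+ z≤n , inj₂ (+<+ (s≤s z≤n)))
surdPos-cone s zero m _ _ (nonneg (suc k) _) = inj₁ (+≤+ z≤n , +≤+ z≤n , inj₁ (+<+ (s≤s z≤n)))
surdPos-cone zero zero m _ () (nonneg zero _)
surdPos-cone (suc s) zero m _ _ (nonneg zero e) with trans e (ℕP.+-identityʳ _)
... | ()
surdPos-cone s zero m _ _ (neg k e) with trans e (ℕP.+-suc _ k)
... | ()
surdPos-cone {D} s (suc t) m m²<D _ (neg k e) =
  inj₂ (inj₂ (-<+ , +<+ (s≤s z≤n) , subst (-[1+ k ] ℤ.* -[1+ k ] ℤ.<_) (sym (+t*+t*+D (suc t) D))
    (+<+ (square-< t m (subst (suc k ≤_) (sym e) (ℕP.m≤n+m (suc k) (2 * s))) m²<D))))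

¬surdPos-negCone : ∀ {D c} s t m → m * m ≤ D → Minus (t * m) (2 * s) c → ¬ SurdPos (+ D) c (ℤ.- + t)
¬surdPos-negCone s zero m _ (nonneg k e) (inj₁ (_ , _ , inj₁ (+<+ 0<k)))
  with ℕP.m+n≡0⇒n≡0 (2 * s) (sym e)
... | refl with 0<k
... | ()
¬surdPos-negCone s zero m _ _ (inj₁ (_ , _ , inj₂ (+<+ ())))
¬surdPos-negCone s zero m _ (neg k e) (inj₁ (() , _))
¬surdPos-negCone s zero m _ _ (inj₂ (inj₁ (_ , +<+ () , _)))
¬surdPos-negCone s zero m _ _ (inj₂ (inj₂ (_ , +<+ () , _)))
¬surdPos-negCone s (suc t) m _ _ (inj₁ (_ , () , _))
¬surdPos-negCone s (suc t) m _ (neg k e) (inj₂ (inj₁ (() , _)))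
¬surdPos-negCone {D} s (suc t) m m²≤D (nonneg k e) (inj₂ (inj₁ (_ , _ , lt))) =
  ℕP.<⇒≱ (ℤP.drop‿+<+ (subst₂ ℤ._<_ (+t*+t*+D (suc t) D) (sym (ℤP.pos-* k k)) lt))
    (square-≤ (suc t) m (subst (k ≤_) (sym e) (ℕP.m≤n+m k (2 * s))) m²≤D)
¬surdPos-negCone s (suc t) m _ _ (inj₂ (inj₂ (_ , () , _)))

¬surdPos-√D≤k : ∀ {D} k → D ≤ suc k * suc k → ¬ SurdPos (+ D) -[1+ k ] 1ℤ
¬surdPos-√D≤k k D≤k² (inj₁ (() , _))
¬surdPos-√D≤k k D≤k² (inj₂ (inj₁ (_ , +<+ () , _)))
¬surdPos-√D≤k {D} k D≤k² (inj₂ (inj₂ (_ , _ , lt))) =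
  ℕP.<⇒≱ (ℤP.drop‿+<+ (subst (+ (suc k * suc k) ℤ.<_) (ℤP.*-identityˡ (+ D)) lt)) D≤k²

module Expansion (p q : ℕ) where

  infixr 25 β·_ β^_·_

  β·_ : Zβ → Zβ
  β·_ = βmul p q

  β^_·_ : ℕ → Zβ → Zβ
  β^_·_ = βpowMul p q

  ⟦_⟧ : List ℕ → Zβ
  ⟦_⟧ = val p q

  β : Zβ
  β = 0ℤ , 1ℤ

  R : ℤ
  R = + p ℤ.- + q

  P : ℤ
  P = + suc p

  βmul-⊕ : ∀ u v → β· (u ⊕ v) ≡ β· u ⊕ β· v
  βmul-⊕ (a , b) (c , d) = cong₂ _,_ (law₁ b d R) (law₂ a b c d P)
    where
    law₁ : ∀ b d R → ℤ.- ((b ℤ.+ d) ℤ.* R) ≡ ℤ.- (b ℤ.* R) ℤ.+ ℤ.- (d ℤ.* R)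
    law₁ = solve-∀
    law₂ : ∀ a b c d P → (a ℤ.+ c) ℤ.+ (b ℤ.+ d) ℤ.* P ≡ (a ℤ.+ b ℤ.* P) ℤ.+ (c ℤ.+ d ℤ.* P)
    law₂ = solve-∀

  βmul-⊝ : ∀ u → β· (⊝ u) ≡ ⊝ β· u
  βmul-⊝ (a , b) = cong₂ _,_ (law₁ b R) (law₂ a b P)
    where
    law₁ : ∀ b R → ℤ.- ((ℤ.- b) ℤ.* R) ≡ ℤ.- (ℤ.- (b ℤ.* R))
    law₁ = solve-∀
    law₂ : ∀ a b P → ℤ.- a ℤ.+ (ℤ.- b) ℤ.* P ≡ ℤ.- (a ℤ.+ b ℤ.* P)
    law₂ = solve-∀

  βmul-⊖ : ∀ u v → β· (u ⊖ v) ≡ β· u ⊖ β· v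
  βmul-⊖ u v = trans (βmul-⊕ u (⊝ v)) (cong (β· u ⊕_) (βmul-⊝ v))

  βpowMul-⊕ : ∀ n u v → β^ n · (u ⊕ v) ≡ β^ n · u ⊕ β^ n · v
  βpowMul-⊕ zero u v = refl
  βpowMul-⊕ (suc n) u v = trans (cong β·_ (βpowMul-⊕ n u v)) (βmul-⊕ (β^ n · u) (β^ n · v))

  βpowMul-⊝ : ∀ n u → β^ n · (⊝ u) ≡ ⊝ β^ n · u
  βpowMul-⊝ zero u = refl
  βpowMul-⊝ (suc n) u = trans (cong β·_ (βpowMul-⊝ n u)) (βmul-⊝ (β^ n · u))

  βpowMul-⊖ : ∀ n u v → β^ n · (u ⊖ v) ≡ β^ n · u ⊖ β^ n · v
  βpowMul-⊖ n u v = trans (βpowMul-⊕ n u (⊝ v)) (cong (β^ n · u ⊕_) (βpowMul-⊝ n v))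

  βpowMul-βmul : ∀ n z → β^ n · β· z ≡ β· β^ n · z
  βpowMul-βmul zero z = refl
  βpowMul-βmul (suc n) z = cong β·_ (βpowMul-βmul n z)

  βpow-+ : ∀ m n → βpow p q (m + n) ≡ β^ m · βpow p q n
  βpow-+ zero n = refl
  βpow-+ (suc m) n = cong β·_ (βpow-+ m n)

  val-0∷ : ∀ ds → ⟦ 0 ∷ ds ⟧ ≡ β· ⟦ ds ⟧
  val-0∷ ds = cong₂ _,_ (ℤP.+-identityˡ _) (ℤP.+-identityˡ _)

  val-++ : ∀ ds es → ⟦ ds ++ es ⟧ ≡ ⟦ ds ⟧ ⊕ β^ length ds · ⟦ es ⟧
  val-++ [] es = sym (⊕-identityˡ ⟦ es ⟧)
  val-++ (d ∷ ds) es = begin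
    ι (+ d) ⊕ β· ⟦ ds ++ es ⟧                                  ≡⟨ cong (λ v → ι (+ d) ⊕ β· v) (val-++ ds es) ⟩
    ι (+ d) ⊕ β· (⟦ ds ⟧ ⊕ β^ length ds · ⟦ es ⟧)              ≡⟨ cong (ι (+ d) ⊕_) (βmul-⊕ ⟦ ds ⟧ _) ⟩
    ι (+ d) ⊕ (β· ⟦ ds ⟧ ⊕ β^ suc (length ds) · ⟦ es ⟧)        ≡⟨ ⊕-assoc (ι (+ d)) (β· ⟦ ds ⟧) _ ⟨
    (ι (+ d) ⊕ β· ⟦ ds ⟧) ⊕ β^ length (d ∷ ds) · ⟦ es ⟧        ∎
    where open ≡-Reasoning

  -- a + bβ = rank − defect · (p + 1 − β)
  rank : Zβ → ℤ
  rank (a , b) = a ℤ.+ b ℤ.* P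

  defect : Zβ → ℤ
  defect = proj₂

  rank-defect-injective : ∀ {u v} → rank u ≡ rank v → defect u ≡ defect v → u ≡ v
  rank-defect-injective {a , b} {c , .b} r≡ refl = cong (_, b) (ℤ+-cancelʳ (b ℤ.* P) a c r≡)

  rank-⊖ : ∀ u v → rank (u ⊖ v) ≡ rank u ℤ.- rank v
  rank-⊖ (a , b) (c , d) = law a b c d P
    where
    law : ∀ a b c d P → (a ℤ.+ ℤ.- c) ℤ.+ (b ℤ.+ ℤ.- d) ℤ.* P ≡ (a ℤ.+ b ℤ.* P) ℤ.- (c ℤ.+ d ℤ.* P)
    law = solve-∀

  rank-digit : ∀ d v → rank (ι (+ d) ⊕ v) ≡ + d ℤ.+ rank v
  rank-digit d (a , b) = law (+ d) a b P
    where
    law : ∀ d a b P → (d ℤ.+ a) ℤ.+ (0ℤ ℤ.+ b) ℤ.* P ≡ d ℤ.+ (a ℤ.+ b ℤ.* P)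
    law = solve-∀

  defect-digit : ∀ d v → defect (ι (+ d) ⊕ v) ≡ defect v
  defect-digit d v = ℤP.+-identityˡ (defect v)

  rank-βmul : ∀ z → rank (β· z) ≡ P ℤ.* rank z ℤ.- R ℤ.* defect z
  rank-βmul (a , b) = law a b P R
    where
    law : ∀ a b P R → ℤ.- (b ℤ.* R) ℤ.+ (a ℤ.+ b ℤ.* P) ℤ.* P ≡ P ℤ.* (a ℤ.+ b ℤ.* P) ℤ.- R ℤ.* b
    law = solve-∀

  -- s + t γ with γ = β − p > 0
  cone : ℕ → ℕ → Zβ
  cone s t = + s ℤ.- + p ℤ.* + t , + t

  InCone : Zβ → Set
  InCone z = ∃₂ λ s t → z ≡ cone s t

  cone-⊕ : ∀ s t s′ t′ → cone s t ⊕ cone s′ t′ ≡ cone (s + s′) (t + t′)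
  cone-⊕ s t s′ t′ = cong₂ _,_
    (trans (law (+ s) (+ t) (+ s′) (+ t′) (+ p))
           (sym (cong₂ (λ x y → x ℤ.- + p ℤ.* y) (ℤP.pos-+ s s′) (ℤP.pos-+ t t′))))
    (sym (ℤP.pos-+ t t′))
    where
    law : ∀ s t s′ t′ p → (s ℤ.- p ℤ.* t) ℤ.+ (s′ ℤ.- p ℤ.* t′) ≡ (s ℤ.+ s′) ℤ.- p ℤ.* (t ℤ.+ t′)
    law = solve-∀

  -- βγ = γ + q
  βmul-cone : ∀ s t → β· cone s t ≡ cone (s * p + t * q) (s + t)
  βmul-cone s t = cong₂ _,_
    (trans (law₁ (+ s) (+ t) (+ p) (+ q))
           (sym (cong₂ (λ x y → x ℤ.- + p ℤ.* y)
                       (trans (ℤP.pos-+ (s * p) (t * q)) (cong₂ ℤ._+_ (ℤP.pos-* s p) (ℤP.pos-* t q)))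
                       (ℤP.pos-+ s t))))
    (trans (cong (λ x → (+ s ℤ.- + p ℤ.* + t) ℤ.+ + t ℤ.* x) (ℤP.pos-+ 1 p))
           (trans (law₂ (+ s) (+ t) (+ p)) (sym (ℤP.pos-+ s t))))
    where
    law₁ : ∀ s t p q → ℤ.- (t ℤ.* (p ℤ.- q)) ≡ (s ℤ.* p ℤ.+ t ℤ.* q) ℤ.- p ℤ.* (s ℤ.+ t)
    law₁ = solve-∀
    law₂ : ∀ s t p → (s ℤ.- p ℤ.* t) ℤ.+ t ℤ.* (1ℤ ℤ.+ p) ≡ s ℤ.+ t
    law₂ = solve-∀

  ι-cone : ∀ d → ι (+ d) ≡ cone d 0
  ι-cone d = cong (_, 0ℤ) (sym (trans (cong (λ x → + d ℤ.- x) (ℤP.*-zeroʳ (+ p))) (ℤP.+-identityʳ (+ d))))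

  InCone-⊕ : ∀ {u v} → InCone u → InCone v → InCone (u ⊕ v)
  InCone-⊕ (s , t , refl) (s′ , t′ , refl) = s + s′ , t + t′ , cone-⊕ s t s′ t′

  InCone-βmul : ∀ {u} → InCone u → InCone (β· u)
  InCone-βmul (s , t , refl) = s * p + t * q , s + t , βmul-cone s t

  InCone-βpowMul : ∀ n {u} → InCone u → InCone (β^ n · u)
  InCone-βpowMul zero c = c
  InCone-βpowMul (suc n) c = InCone-βmul (InCone-βpowMul n c)

  InCone-val : ∀ ds → InCone ⟦ ds ⟧
  InCone-val [] = 0 , 0 , ι-cone 0
  InCone-val (d ∷ ds) = InCone-⊕ (d , 0 , ι-cone d) (InCone-βmul (InCone-val ds))

  rank-cone : ∀ s t → rank (cone s t) ≡ + (s + t)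
  rank-cone s t = trans (cong (λ x → (+ s ℤ.- + p ℤ.* + t) ℤ.+ + t ℤ.* x) (ℤP.pos-+ 1 p))
                        (trans (law (+ s) (+ t) (+ p)) (sym (ℤP.pos-+ s t)))
    where
    law : ∀ s t p → (s ℤ.- p ℤ.* t) ℤ.+ t ℤ.* (1ℤ ℤ.+ p) ≡ s ℤ.+ t
    law = solve-∀

  module Bounded (1≤q : 1 ≤ q) (q<p : q < p) where

    1≤p : 1 ≤ p
    1≤p = ℕP.≤-trans 1≤q (ℕP.<⇒≤ q<p)

    p₁ : ℕ
    p₁ = pred p

    p≡1+p₁ : p ≡ suc p₁
    p≡1+p₁ = sym (ℕP.suc-pred p {{>-nonZero 1≤p}})

    r : ℕ
    r = p ∸ q

    q+r≡p : q + r ≡ p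
    q+r≡p = ℕP.m+[n∸m]≡n (ℕP.<⇒≤ q<p)

    R≡+r : R ≡ + r
    R≡+r = trans (ℤP.m-n≡m⊖n p q) (ℤP.⊖-≥ (ℕP.<⇒≤ q<p))

    R≡+[1+pred-r] : R ≡ +[1+ pred r ]
    R≡+[1+pred-r] = trans R≡+r (cong +_ (sym (ℕP.suc-pred r {{>-nonZero (ℕP.m<n⇒0<n∸m q<p)}})))

    -- disc p q = (p − 1)² + 4q lies strictly between (p − 1)² and (p + 1)², so p < β < p + 1
    Dn : ℕ
    Dn = p₁ * p₁ + 4 * q

    disc≡Dn : disc p q ≡ + Dn
    disc≡Dn = subst (λ x → disc x q ≡ + (pred x * pred x + 4 * q)) (sym p≡1+p₁) (disc-suc p₁)
      where
      law : ∀ a q → (+ 2 ℤ.+ a) ℤ.* (+ 2 ℤ.+ a) ℤ.- + 4 ℤ.* ((1ℤ ℤ.+ a) ℤ.- q) ≡ a ℤ.* a ℤ.+ + 4 ℤ.* q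
      law = solve-∀
      disc-suc : ∀ a → disc (suc a) q ≡ + (a * a + 4 * q)
      disc-suc a = begin
        disc (suc a) q                          ≡⟨ cong₂ (λ x y → x ℤ.* x ℤ.- + 4 ℤ.* (y ℤ.- + q)) (ℤP.pos-+ 2 a) (ℤP.pos-+ 1 a) ⟩
        (+ 2 ℤ.+ + a) ℤ.* (+ 2 ℤ.+ + a) ℤ.- + 4 ℤ.* ((1ℤ ℤ.+ + a) ℤ.- + q) ≡⟨ law (+ a) (+ q) ⟩
        + a ℤ.* + a ℤ.+ + 4 ℤ.* + q             ≡⟨ cong₂ ℤ._+_ (ℤP.pos-* a a) (ℤP.pos-* 4 q) ⟨
        + (a * a) ℤ.+ + (4 * q)                 ≡⟨ ℤP.pos-+ (a * a) (4 * q) ⟨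
        + (a * a + 4 * q)                       ∎
        where open ≡-Reasoning

    p₁²<Dn : p₁ * p₁ < Dn
    p₁²<Dn = ℕP.m<m+n (p₁ * p₁) (ℕP.<-≤-trans (s≤s z≤n) (ℕP.*-monoʳ-≤ 4 1≤q))

    Dn≤[1+p]² : Dn ≤ suc p * suc p
    Dn≤[1+p]² = begin
      p₁ * p₁ + 4 * q            ≤⟨ ℕP.+-monoʳ-≤ (p₁ * p₁) (ℕP.*-monoʳ-≤ 4 q≤1+p₁) ⟩
      p₁ * p₁ + 4 * suc p₁       ≡⟨ law p₁ ⟩
      suc (suc p₁) * suc (suc p₁) ≡⟨ cong (λ x → suc x * suc x) p≡1+p₁ ⟨
      suc p * suc p              ∎
      where
      open ℕP.≤-Reasoning
      q≤1+p₁ : q ≤ suc p₁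
      q≤1+p₁ = ℕP.≤-trans (ℕP.<⇒≤ q<p) (ℕP.≤-reflexive p≡1+p₁)
      law : ∀ a → a * a + 4 * suc a ≡ suc (suc a) * suc (suc a)
      law = solveℕ-∀

    pos-fromSurd : ∀ z {c} → + 2 ℤ.* proj₁ z ℤ.+ proj₂ z ℤ.* P ≡ c → SurdPos (+ Dn) c (proj₂ z) → Pos p q z
    pos-fromSurd z refl x rewrite disc≡Dn = x

    pos-toSurd : ∀ z {c} → + 2 ℤ.* proj₁ z ℤ.+ proj₂ z ℤ.* P ≡ c → Pos p q z → SurdPos (+ Dn) c (proj₂ z)
    pos-toSurd z refl x rewrite disc≡Dn = x

    cone-surd : ∀ s t → + 2 ℤ.* proj₁ (cone s t) ℤ.+ + t ℤ.* P ≡ + (2 * s) ℤ.- + (t * p₁)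
    cone-surd s t = begin
      + 2 ℤ.* (+ s ℤ.- + p ℤ.* + t) ℤ.+ + t ℤ.* (1ℤ ℤ.+ + p)
        ≡⟨ cong (λ x → + 2 ℤ.* (+ s ℤ.- x ℤ.* + t) ℤ.+ + t ℤ.* (1ℤ ℤ.+ x)) (cong +_ p≡1+p₁) ⟩
      + 2 ℤ.* (+ s ℤ.- (1ℤ ℤ.+ + p₁) ℤ.* + t) ℤ.+ + t ℤ.* (1ℤ ℤ.+ (1ℤ ℤ.+ + p₁))
        ≡⟨ law (+ s) (+ t) (+ p₁) ⟩
      + 2 ℤ.* + s ℤ.- + t ℤ.* + p₁
        ≡⟨ cong₂ ℤ._-_ (ℤP.pos-* 2 s) (ℤP.pos-* t p₁) ⟨
      + (2 * s) ℤ.- + (t * p₁) ∎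
      where
      open ≡-Reasoning
      law : ∀ s t a → + 2 ℤ.* (s ℤ.- (1ℤ ℤ.+ a) ℤ.* t) ℤ.+ t ℤ.* (1ℤ ℤ.+ (1ℤ ℤ.+ a)) ≡ + 2 ℤ.* s ℤ.- t ℤ.* a
      law = solve-∀

    ⊝cone-surd : ∀ s t → + 2 ℤ.* proj₁ (⊝ cone s t) ℤ.+ proj₂ (⊝ cone s t) ℤ.* P ≡ + (t * p₁) ℤ.- + (2 * s)
    ⊝cone-surd s t = trans (law₁ (proj₁ (cone s t)) (+ t) P)
                           (trans (cong ℤ.-_ (cone-surd s t)) (law₂ (+ (2 * s)) (+ (t * p₁))))
      where
      law₁ : ∀ x y P → + 2 ℤ.* ℤ.- x ℤ.+ ℤ.- y ℤ.* P ≡ ℤ.- (+ 2 ℤ.* x ℤ.+ y ℤ.* P)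
      law₁ = solve-∀
      law₂ : ∀ a b → ℤ.- (a ℤ.- b) ≡ b ℤ.- a
      law₂ = solve-∀

    cone-pos : ∀ s t → 1 ≤ s + t → Pos p q (cone s t)
    cone-pos s t 1≤s+t = pos-fromSurd (cone s t) (cone-surd s t) (surdPos-cone s t p₁ p₁²<Dn 1≤s+t (minus _ _))

    ¬pos-⊝cone : ∀ s t → ¬ Pos p q (⊝ cone s t)
    ¬pos-⊝cone s t x = ¬surdPos-negCone s t p₁ (ℕP.<⇒≤ p₁²<Dn) (minus _ _) (pos-toSurd (⊝ cone s t) (⊝cone-surd s t) x)

    ¬pos-⊝InCone : ∀ {z} → InCone z → ¬ Pos p q (⊝ z)
    ¬pos-⊝InCone (s , t , refl) = ¬pos-⊝cone s t

    pos-InCone : ∀ {z n} → InCone z → rank z ≡ + suc n → Pos p q z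
    pos-InCone (s , t , refl) rank≡ =
      cone-pos s t (subst (1 ≤_) (sym (ℤP.+-injective (trans (sym (rank-cone s t)) rank≡))) (s≤s z≤n))

    β-below-1+p : ∀ e → suc p ≤ e → ¬ Pos p q (⊝ (ι (+ e) ⊖ β))
    β-below-1+p e p<e x = below (minus (suc p) (2 * e)) (pos-toSurd (⊝ (ι (+ e) ⊖ β)) surd x)
      where
      law : ∀ e P → + 2 ℤ.* ℤ.- (e ℤ.+ ℤ.- 0ℤ) ℤ.+ ℤ.- (0ℤ ℤ.+ ℤ.- 1ℤ) ℤ.* P ≡ P ℤ.- + 2 ℤ.* e
      law = solve-∀
      surd : + 2 ℤ.* ℤ.- (+ e ℤ.+ ℤ.- 0ℤ) ℤ.+ ℤ.- (0ℤ ℤ.+ ℤ.- 1ℤ) ℤ.* P ≡ + suc p ℤ.- + (2 * e)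
      surd = trans (law (+ e) P) (cong (λ x → P ℤ.- x) (sym (ℤP.pos-* 2 e)))
      2p+2≤2e : suc p + suc p ≤ 2 * e
      2p+2≤2e = ℕP.+-mono-≤ p<e (ℕP.≤-trans p<e (ℕP.m≤m+n e 0))
      below : ∀ {c} → Minus (suc p) (2 * e) c → ¬ SurdPos (+ Dn) c 1ℤ
      below (nonneg k 1+p≡2e+k) _ =
        ℕP.<-irrefl refl (ℕP.<-≤-trans (ℕP.m<m+n (suc p) (s≤s z≤n))
          (ℕP.≤-trans 2p+2≤2e (ℕP.≤-trans (ℕP.m≤m+n (2 * e) k) (ℕP.≤-reflexive (sym 1+p≡2e+k)))))
      below (neg k 2e≡1+p+1+k) = ¬surdPos-√D≤k k (ℕP.≤-trans Dn≤[1+p]² (ℕP.*-mono-≤ 1+p≤1+k 1+p≤1+k))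
        where
        1+p≤1+k : suc p ≤ suc k
        1+p≤1+k = ℕP.+-cancelˡ-≤ (suc p) (suc p) (suc k) (ℕP.≤-trans 2p+2≤2e (ℕP.≤-reflexive 2e≡1+p+1+k))

    -- Parry's condition as an automaton: after a digit p the following digits must stay ≤ q as long
    -- as they equal q.  Digit lists are little-endian, so the automaton reads them from the end.
    data State : Set where
      loose tight : State

    cap : State → ℕ
    cap loose = p
    cap tight = q

    next : State → ℕ → State
    next s d with d ≟ cap s
    ... | yes _ = tight
    ... | no _  = loose

    next-≡cap : ∀ s d → d ≡ cap s → next s d ≡ tight
    next-≡cap s d d≡ with d ≟ cap s
    ... | yes _ = refl
    ... | no d≢ = ⊥-elim (d≢ d≡)

    next-≢cap : ∀ s d → d ≢ cap s → next s d ≡ loose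
    next-≢cap s d d≢ with d ≟ cap s
    ... | yes d≡ = ⊥-elim (d≢ d≡)
    ... | no _ = refl

    next≡tight⇒≡cap : ∀ s d → next s d ≡ tight → d ≡ cap s
    next≡tight⇒≡cap s d e with d ≟ cap s
    ... | yes d≡ = d≡
    next≡tight⇒≡cap s d () | no _

    state : List ℕ → State
    state [] = loose
    state (d ∷ ds) = next (state ds) d

    Admissible : List ℕ → Set
    Admissible [] = ⊤
    Admissible (d ∷ ds) = Admissible ds × d ≤ cap (state ds)

    cap≥1 : ∀ s → 1 ≤ cap s
    cap≥1 loose = 1≤p
    cap≥1 tight = 1≤q

    cap≡suc-pred : ∀ s → cap s ≡ suc (pred (cap s))
    cap≡suc-pred s = sym (ℕP.suc-pred (cap s) {{>-nonZero (cap≥1 s)}})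

    q<cap⇒loose : ∀ s → q < cap s → s ≡ loose
    q<cap⇒loose loose _ = refl
    q<cap⇒loose tight q<q = ⊥-elim (ℕP.<-irrefl refl q<q)

    succ : List ℕ → List ℕ
    succ [] = 1 ∷ []
    succ (d ∷ ds) with d <? cap (state ds)
    ... | yes _ = suc d ∷ ds
    ... | no _  = 0 ∷ succ ds

    succ-< : ∀ d ds → d < cap (state ds) → succ (d ∷ ds) ≡ suc d ∷ ds
    succ-< d ds d< with d <? cap (state ds)
    ... | yes _ = refl
    ... | no d≮ = ⊥-elim (d≮ d<)

    succ-≮ : ∀ d ds → ¬ d < cap (state ds) → succ (d ∷ ds) ≡ 0 ∷ succ ds
    succ-≮ d ds d≮ with d <? cap (state ds)
    ... | yes d< = ⊥-elim (d≮ d<)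
    ... | no _ = refl

    admissible-succ : ∀ ds → Admissible ds → Admissible (succ ds)
    admissible-succ [] _ = tt , 1≤p
    admissible-succ (d ∷ ds) (adm , _) with d <? cap (state ds)
    ... | yes d< = adm , d<
    ... | no _ = admissible-succ ds adm , z≤n

    enum : ℕ → List ℕ
    enum zero = []
    enum (suc n) = succ (enum n)

    admissible-enum : ∀ n → Admissible (enum n)
    admissible-enum zero = tt
    admissible-enum (suc n) = admissible-succ (enum n) (admissible-enum n)

    enumState : ℕ → State
    enumState n = state (enum n)

    isTight : State → ℕ
    isTight loose = 0
    isTight tight = 1

    tights : ℕ → ℕ
    tights zero = 0
    tights (suc n) = tights n + isTight (enumState n)

    -- the lists enum (blockStart n + j), j ≤ cap (enumState n), are j ∷ enum n (up to n = j = 0)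
    blockStart : ℕ → ℕ
    blockStart zero = 0
    blockStart (suc n) = blockStart n + suc (cap (enumState n))

    mutual
      enum-blockStart : ∀ n → enum (blockStart (suc n)) ≡ 0 ∷ enum (suc n)
      enum-blockStart n = begin
        enum (blockStart n + suc (cap s))    ≡⟨ cong enum (ℕP.+-suc (blockStart n) (cap s)) ⟩
        succ (enum (blockStart n + cap s))   ≡⟨ cong (λ c → succ (enum (blockStart n + c))) (cap≡suc-pred s) ⟩
        succ (enum (blockStart n + suc c))   ≡⟨ cong succ (enum-inBlock n c (ℕP.≤-reflexive (sym (cap≡suc-pred s)))) ⟩
        succ (suc c ∷ enum n)                ≡⟨ succ-≮ (suc c) (enum n) (ℕP.<-irrefl (sym (cap≡suc-pred s))) ⟩
        0 ∷ enum (suc n)                     ∎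
        where
        open ≡-Reasoning
        s = enumState n
        c = pred (cap s)

      enum-inBlock : ∀ n j → suc j ≤ cap (enumState n) → enum (blockStart n + suc j) ≡ suc j ∷ enum n
      enum-inBlock zero zero _ = refl
      enum-inBlock (suc n) zero 1≤cap = begin
        enum (blockStart (suc n) + 1)      ≡⟨ cong enum (ℕP.+-comm (blockStart (suc n)) 1) ⟩
        succ (enum (blockStart (suc n)))   ≡⟨ cong succ (enum-blockStart n) ⟩
        succ (0 ∷ enum (suc n))            ≡⟨ succ-< 0 (enum (suc n)) 1≤cap ⟩
        1 ∷ enum (suc n)                   ∎
        where open ≡-Reasoning
      enum-inBlock n (suc j) j<cap = begin
        enum (blockStart n + suc (suc j))  ≡⟨ cong enum (ℕP.+-suc (blockStart n) (suc j)) ⟩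
        succ (enum (blockStart n + suc j)) ≡⟨ cong succ (enum-inBlock n j (ℕP.<⇒≤ j<cap)) ⟩
        succ (suc j ∷ enum n)              ≡⟨ succ-< (suc j) (enum n) j<cap ⟩
        suc (suc j) ∷ enum n               ∎
        where open ≡-Reasoning

    enum-blockStart′ : ∀ n → enum (blockStart (suc n) + 0) ≡ 0 ∷ enum (suc n)
    enum-blockStart′ n = trans (cong enum (ℕP.+-identityʳ (blockStart (suc n)))) (enum-blockStart n)

    val-enum-inBlock : ∀ n j → j ≤ cap (enumState n) → ⟦ enum (blockStart n + j) ⟧ ≡ ⟦ j ∷ enum n ⟧
    val-enum-inBlock zero zero _ = refl
    val-enum-inBlock (suc n) zero _ = cong ⟦_⟧ (enum-blockStart′ n)
    val-enum-inBlock n (suc j) j<cap = cong ⟦_⟧ (enum-inBlock n j j<cap)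

    enumState-inBlock : ∀ n j → j ≤ cap (enumState n) → enumState (blockStart n + j) ≡ next (enumState n) j
    enumState-inBlock zero zero _ = sym (next-≢cap loose 0 (λ 0≡p → ℕP.<-irrefl 0≡p 1≤p))
    enumState-inBlock (suc n) zero _ = cong state (enum-blockStart′ n)
    enumState-inBlock n (suc j) j<cap = cong state (enum-inBlock n j j<cap)

    tights-inBlock : ∀ n j → j ≤ cap (enumState n) → tights (blockStart n + j) ≡ n
    tights-inBlock zero zero _ = refl
    tights-inBlock (suc n) zero _ = begin
      tights (blockStart n + suc (cap s) + 0)
        ≡⟨ cong tights (trans (ℕP.+-identityʳ _) (ℕP.+-suc (blockStart n) (cap s))) ⟩
      tights (blockStart n + cap s) + isTight (enumState (blockStart n + cap s))
        ≡⟨ cong₂ _+_ (tights-inBlock n (cap s) ℕP.≤-refl)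
                     (cong isTight (trans (enumState-inBlock n (cap s) ℕP.≤-refl) (next-≡cap s (cap s) refl))) ⟩
      n + 1
        ≡⟨ ℕP.+-comm n 1 ⟩
      suc n ∎
      where
      open ≡-Reasoning
      s = enumState n
    tights-inBlock n (suc j) j<cap = begin
      tights (blockStart n + suc j)
        ≡⟨ cong tights (ℕP.+-suc (blockStart n) j) ⟩
      tights (blockStart n + j) + isTight (enumState (blockStart n + j))
        ≡⟨ cong₂ _+_ (tights-inBlock n j (ℕP.<⇒≤ j<cap))
                     (cong isTight (trans (enumState-inBlock n j (ℕP.<⇒≤ j<cap))
                                          (next-≢cap (enumState n) j (λ j≡ → ℕP.<-irrefl j≡ j<cap)))) ⟩
      n + 0
        ≡⟨ ℕP.+-identityʳ n ⟩
      n ∎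
      where open ≡-Reasoning

    inBlock : ∀ m → ∃₂ λ n j → j ≤ cap (enumState n) × m ≡ blockStart n + j
    inBlock zero = 0 , 0 , z≤n , refl
    inBlock (suc m) with inBlock m
    ... | n , j , j≤cap , refl with j <? cap (enumState n)
    ...   | yes j<cap = n , suc j , j<cap , sym (ℕP.+-suc (blockStart n) j)
    ...   | no j≮cap = suc n , 0 , z≤n , (begin
      suc (blockStart n + j)           ≡⟨ ℕP.+-suc (blockStart n) j ⟨
      blockStart n + suc j             ≡⟨ cong (λ i → blockStart n + suc i) (ℕP.≤-antisym j≤cap (ℕP.≮⇒≥ j≮cap)) ⟩
      blockStart (suc n)               ≡⟨ ℕP.+-identityʳ _ ⟨
      blockStart (suc n) + 0           ∎)
      where open ≡-Reasoning

    capIsTight : ∀ s → cap s + r * isTight s ≡ p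
    capIsTight loose = trans (cong (λ x → p + x) (ℕP.*-zeroʳ r)) (ℕP.+-identityʳ p)
    capIsTight tight = trans (cong (λ x → q + x) (ℕP.*-identityʳ r)) q+r≡p

    blockStart-tights : ∀ n → blockStart n + r * tights n ≡ suc p * n
    blockStart-tights zero = trans (ℕP.*-zeroʳ r) (sym (ℕP.*-zeroʳ p))
    blockStart-tights (suc n) = begin
      blockStart n + suc (cap s) + r * (tights n + isTight s)
        ≡⟨ law (blockStart n) (cap s) r (tights n) (isTight s) ⟩
      (blockStart n + r * tights n) + suc (cap s + r * isTight s)
        ≡⟨ cong₂ (λ a c → a + suc c) (blockStart-tights n) (capIsTight s) ⟩
      suc p * n + suc p
        ≡⟨ trans (ℕP.+-comm (suc p * n) (suc p)) (sym (ℕP.*-suc (suc p) n)) ⟩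
      suc p * suc n ∎
      where
      open ≡-Reasoning
      s = enumState n
      law : ∀ l c r t i → l + suc c + r * (t + i) ≡ (l + r * t) + suc (c + r * i)
      law = solveℕ-∀

    blockStart-mono : ∀ {m n} → m ≤ n → blockStart m ≤ blockStart n
    blockStart-mono = ≤-stepwise-mono blockStart (λ n → ℕP.m≤m+n (blockStart n) _)

    tights-mono : ∀ {m n} → m ≤ n → tights m ≤ tights n
    tights-mono = ≤-stepwise-mono tights (λ n → ℕP.m≤m+n (tights n) _)

    tights-suc≤ : ∀ n → tights (suc n) ≤ suc (tights n)
    tights-suc≤ n = subst (tights (suc n) ≤_) (ℕP.+-comm (tights n) 1) (ℕP.+-monoʳ-≤ (tights n) (isTight≤1 (enumState n)))
      where
      isTight≤1 : ∀ s → isTight s ≤ 1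
      isTight≤1 loose = z≤n
      isTight≤1 tight = s≤s z≤n

    2n≤blockStart : ∀ n → n + n ≤ blockStart n
    2n≤blockStart zero = z≤n
    2n≤blockStart (suc n) = begin
      suc n + suc n                           ≡⟨ cong suc (ℕP.+-suc n n) ⟩
      suc (suc (n + n))                       ≡⟨ ℕP.+-comm 2 (n + n) ⟩
      n + n + 2                               ≤⟨ ℕP.+-mono-≤ (2n≤blockStart n) (s≤s (cap≥1 (enumState n))) ⟩
      blockStart n + suc (cap (enumState n))  ∎
      where open ℕP.≤-Reasoning

    blockStart-tights≤ : ∀ m → blockStart (tights m) ≤ m
    blockStart-tights≤ m with inBlock m
    ... | n , j , j≤cap , refl = subst (λ k → blockStart k ≤ blockStart n + j) (sym (tights-inBlock n j j≤cap))
                                       (ℕP.m≤m+n (blockStart n) j)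

    inBlock-index-≤ : ∀ n n′ j → blockStart n ≤ blockStart n′ + j → j ≤ cap (enumState n′) → n ≤ n′
    inBlock-index-≤ n n′ j L≤ j≤cap = ℕP.≮⇒≥ λ n′<n → ℕP.<⇒≱ (L<L n′<n) L≤
      where
      L<L : n′ < n → blockStart n′ + j < blockStart n
      L<L n′<n = ℕP.<-≤-trans (ℕP.+-monoʳ-< (blockStart n′) (s≤s j≤cap)) (blockStart-mono n′<n)

    -- Superadditivity of the defect

    cap≤p : ∀ s → cap s ≤ p
    cap≤p loose = ℕP.≤-refl
    cap≤p tight = ℕP.<⇒≤ q<p

    blockStart-excess : ∀ n k j → blockStart n + blockStart (suc k) ≤ blockStart (n + k) + j →
                        suc p + r * tights (n + k) ≤ j + r * (tights n + tights (suc k))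
    blockStart-excess n k j L≤ = ℕP.+-cancelˡ-≤ (suc p * (n + k)) _ _ (begin
      suc p * (n + k) + (suc p + r * Cnk)        ≡⟨ law₁ (suc p) n k r Cnk ⟩
      suc p * n + suc p * suc k + r * Cnk        ≡⟨ cong₂ (λ a b → a + b + r * Cnk) (blockStart-tights n) (blockStart-tights (suc k)) ⟨
      (Ln + r * Cn) + (Lk + r * Ck) + r * Cnk    ≡⟨ law₂ Ln Lk Cn Ck r Cnk ⟩
      (Ln + Lk) + (r * Cn + r * Ck + r * Cnk)    ≤⟨ ℕP.+-monoˡ-≤ (r * Cn + r * Ck + r * Cnk) L≤ ⟩
      (Lnk + j) + (r * Cn + r * Ck + r * Cnk)    ≡⟨ law₃ Lnk j r Cn Ck Cnk ⟩
      (Lnk + r * Cnk) + (j + r * (Cn + Ck))      ≡⟨ cong (λ a → a + (j + r * (Cn + Ck))) (blockStart-tights (n + k)) ⟩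
      suc p * (n + k) + (j + r * (Cn + Ck))      ∎)
      where
      open ℕP.≤-Reasoning
      Ln = blockStart n
      Lk = blockStart (suc k)
      Lnk = blockStart (n + k)
      Cn = tights n
      Ck = tights (suc k)
      Cnk = tights (n + k)
      law₁ : ∀ P n k r c → P * (n + k) + (P + r * c) ≡ P * n + P * suc k + r * c
      law₁ = solveℕ-∀
      law₂ : ∀ a b c d r e → (a + r * c) + (b + r * d) + r * e ≡ (a + b) + (r * c + r * d + r * e)
      law₂ = solveℕ-∀
      law₃ : ∀ a j r c d e → (a + j) + (r * c + r * d + r * e) ≡ (a + r * e) + (j + r * (c + d))
      law₃ = solveℕ-∀

    SuperadditiveAt : ℕ → Set
    SuperadditiveAt m = ∀ s → tights s + tights m ≤ tights (s + m)

    -- As blockStart n = (p + 1) n − (p − q) tights n, a block n + k starting too early to hold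
    -- blockStart n + m would need more than q digits (so it is loose) and still
    -- tights (n + k + 1) > tights (n + k).
    tights-no-overflow : ∀ {m} → (∀ {k} → k < m → SuperadditiveAt k) → ∀ n k j →
                         suc k ≤ tights m → blockStart n + m ≡ blockStart (n + k) + j →
                         j ≤ cap (enumState (n + k)) → ⊥
    tights-no-overflow {m} ih n k j k<Cm L≡ j≤cap = ℕP.<⇒≱ C<S (subst (S ≤_) noTight (ih 1+k<m n))
      where
      C = tights (n + k)
      S = tights n + tights (suc k)
      Lk1≤m : blockStart (suc k) ≤ m
      Lk1≤m = ℕP.≤-trans (blockStart-mono k<Cm) (blockStart-tights≤ m)
      1+k<m : suc k < m
      1+k<m = ℕP.<-≤-trans (ℕP.m<m+n (suc k) (s≤s z≤n)) (ℕP.≤-trans (2n≤blockStart (suc k)) Lk1≤m)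
      excess : suc p + r * C ≤ j + r * S
      excess = blockStart-excess n k j (ℕP.≤-trans (ℕP.+-monoʳ-≤ (blockStart n) Lk1≤m) (ℕP.≤-reflexive L≡))
      S≤1+C : S ≤ suc C
      S≤1+C = begin
        tights n + tights (suc k)   ≤⟨ ℕP.+-monoʳ-≤ (tights n) (tights-suc≤ k) ⟩
        tights n + suc (tights k)   ≡⟨ ℕP.+-suc (tights n) (tights k) ⟩
        suc (tights n + tights k)   ≤⟨ s≤s (ih (ℕP.<-trans (ℕP.n<1+n k) 1+k<m) n) ⟩
        suc C                       ∎
        where open ℕP.≤-Reasoning
      q<j : q < j
      q<j = ℕP.+-cancelʳ-≤ r (suc q) j (begin
        suc q + r      ≡⟨ cong suc q+r≡p ⟩
        suc p          ≤⟨ ℕP.+-cancelʳ-≤ (r * C) (suc p) (j + r) (begin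
          suc p + r * C    ≤⟨ excess ⟩
          j + r * S        ≤⟨ ℕP.+-monoʳ-≤ j (ℕP.*-monoʳ-≤ r S≤1+C) ⟩
          j + r * suc C    ≡⟨ law j r C ⟩
          j + r + r * C    ∎) ⟩
        j + r          ∎)
        where
        open ℕP.≤-Reasoning
        law : ∀ j r c → j + r * suc c ≡ j + r + r * c
        law = solveℕ-∀
      noTight : tights (n + suc k) ≡ C
      noTight = begin
        tights (n + suc k)                        ≡⟨ cong tights (ℕP.+-suc n k) ⟩
        C + isTight (enumState (n + k))           ≡⟨ cong (λ s → C + isTight s) (q<cap⇒loose _ (ℕP.<-≤-trans q<j j≤cap)) ⟩
        C + 0                                     ≡⟨ ℕP.+-identityʳ C ⟩
        C                                         ∎
        where open ≡-Reasoning
      C<S : C < S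
      C<S = ℕP.*-cancelˡ-< r C S (ℕP.+-cancelˡ-< p (r * C) (r * S)
              (ℕP.≤-trans excess (ℕP.+-monoˡ-≤ (r * S) (ℕP.≤-trans j≤cap (cap≤p _)))))

    tights-superadditive : ∀ m → SuperadditiveAt m
    tights-superadditive = <-rec SuperadditiveAt step
      where
      step : ∀ m → (∀ {k} → k < m → SuperadditiveAt k) → SuperadditiveAt m
      step m ih s with inBlock s
      ... | n , j , j≤cap , refl = begin
        tights (blockStart n + j) + tights m  ≡⟨ cong (λ c → c + tights m) (tights-inBlock n j j≤cap) ⟩
        n + tights m                          ≤⟨ bound ⟩
        tights (blockStart n + m)             ≤⟨ tights-mono (ℕP.+-monoˡ-≤ m (ℕP.m≤m+n (blockStart n) j)) ⟩
        tights (blockStart n + j + m)         ∎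
        where
        open ℕP.≤-Reasoning
        bound : n + tights m ≤ tights (blockStart n + m)
        bound with inBlock (blockStart n + m)
        ... | n′ , j′ , j′≤cap , L≡
          with ℕP.m≤n⇒∃[o]m+o≡n
                 (inBlock-index-≤ n n′ j′ (ℕP.≤-trans (ℕP.m≤m+n (blockStart n) m) (ℕP.≤-reflexive L≡)) j′≤cap)
        ... | k , refl with tights m ≤? k
        ...   | yes Cm≤k = subst (n + tights m ≤_) (sym (trans (cong tights L≡) (tights-inBlock (n + k) j′ j′≤cap)))
                                 (ℕP.+-monoʳ-≤ n Cm≤k)
        ...   | no Cm≰k = ⊥-elim (tights-no-overflow ih n k j′ (ℕP.≰⇒> Cm≰k) L≡ j′≤cap)

    -- Rank and defect of admissible values

    P≡1+cap+R*isTight : ∀ s → P ≡ 1ℤ ℤ.+ (+ cap s ℤ.+ R ℤ.* + isTight s)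
    P≡1+cap+R*isTight s = cong (λ x → 1ℤ ℤ.+ x) (sym (begin
      + cap s ℤ.+ R ℤ.* + isTight s        ≡⟨ cong (λ x → + cap s ℤ.+ x ℤ.* + isTight s) R≡+r ⟩
      + cap s ℤ.+ + r ℤ.* + isTight s      ≡⟨ cong (λ x → + cap s ℤ.+ x) (ℤP.pos-* r (isTight s)) ⟨
      + cap s ℤ.+ + (r * isTight s)        ≡⟨ ℤP.pos-+ (cap s) (r * isTight s) ⟨
      + (cap s + r * isTight s)            ≡⟨ cong +_ (capIsTight s) ⟩
      + p                                  ∎))
      where open ≡-Reasoning

    mutual
      rank-succ : ∀ ds → Admissible ds → rank ⟦ succ ds ⟧ ≡ rank ⟦ ds ⟧ ℤ.+ 1ℤ
      rank-succ [] _ = refl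
      rank-succ (d ∷ ds) (adm , d≤cap) with d <? cap (state ds)
      ... | yes _ = begin
        rank ⟦ suc d ∷ ds ⟧                  ≡⟨ rank-digit (suc d) (β· ⟦ ds ⟧) ⟩
        + suc d ℤ.+ rank (β· ⟦ ds ⟧)         ≡⟨ law (+ d) (rank (β· ⟦ ds ⟧)) ⟩
        (+ d ℤ.+ rank (β· ⟦ ds ⟧)) ℤ.+ 1ℤ    ≡⟨ cong (ℤ._+ 1ℤ) (rank-digit d (β· ⟦ ds ⟧)) ⟨
        rank ⟦ d ∷ ds ⟧ ℤ.+ 1ℤ               ∎
        where
        open ≡-Reasoning
        law : ∀ d x → (1ℤ ℤ.+ d) ℤ.+ x ≡ (d ℤ.+ x) ℤ.+ 1ℤ
        law = solve-∀
      ... | no d≮cap = begin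
        rank ⟦ 0 ∷ succ ds ⟧
          ≡⟨ trans (rank-digit 0 (β· ⟦ succ ds ⟧)) (ℤP.+-identityˡ _) ⟩
        rank (β· ⟦ succ ds ⟧)
          ≡⟨ rank-βmul ⟦ succ ds ⟧ ⟩
        P ℤ.* rank ⟦ succ ds ⟧ ℤ.- R ℤ.* defect ⟦ succ ds ⟧
          ≡⟨ cong₂ (λ a b → P ℤ.* a ℤ.- R ℤ.* b) (rank-succ ds adm) (defect-succ ds adm) ⟩
        P ℤ.* (n₀ ℤ.+ 1ℤ) ℤ.- R ℤ.* (k₀ ℤ.+ + isTight s)
          ≡⟨ cong (λ P′ → P′ ℤ.* (n₀ ℤ.+ 1ℤ) ℤ.- R ℤ.* (k₀ ℤ.+ + isTight s)) (P≡1+cap+R*isTight s) ⟩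
        (1ℤ ℤ.+ (+ cap s ℤ.+ R ℤ.* + isTight s)) ℤ.* (n₀ ℤ.+ 1ℤ) ℤ.- R ℤ.* (k₀ ℤ.+ + isTight s)
          ≡⟨ law n₀ k₀ (+ cap s) (+ isTight s) R ⟩
        + cap s ℤ.+ ((1ℤ ℤ.+ (+ cap s ℤ.+ R ℤ.* + isTight s)) ℤ.* n₀ ℤ.- R ℤ.* k₀) ℤ.+ 1ℤ
          ≡⟨ cong₂ (λ c P′ → + c ℤ.+ (P′ ℤ.* n₀ ℤ.- R ℤ.* k₀) ℤ.+ 1ℤ) (sym d≡cap) (sym (P≡1+cap+R*isTight s)) ⟩
        + d ℤ.+ (P ℤ.* n₀ ℤ.- R ℤ.* k₀) ℤ.+ 1ℤ
          ≡⟨ cong (λ x → + d ℤ.+ x ℤ.+ 1ℤ) (rank-βmul ⟦ ds ⟧) ⟨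
        + d ℤ.+ rank (β· ⟦ ds ⟧) ℤ.+ 1ℤ
          ≡⟨ cong (ℤ._+ 1ℤ) (rank-digit d (β· ⟦ ds ⟧)) ⟨
        rank ⟦ d ∷ ds ⟧ ℤ.+ 1ℤ ∎
        where
        open ≡-Reasoning
        s = state ds
        n₀ = rank ⟦ ds ⟧
        k₀ = defect ⟦ ds ⟧
        d≡cap : d ≡ cap s
        d≡cap = ℕP.≤-antisym d≤cap (ℕP.≮⇒≥ d≮cap)
        law : ∀ n k c i R → (1ℤ ℤ.+ (c ℤ.+ R ℤ.* i)) ℤ.* (n ℤ.+ 1ℤ) ℤ.- R ℤ.* (k ℤ.+ i)
                          ≡ c ℤ.+ ((1ℤ ℤ.+ (c ℤ.+ R ℤ.* i)) ℤ.* n ℤ.- R ℤ.* k) ℤ.+ 1ℤ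
        law = solve-∀

      defect-succ : ∀ ds → Admissible ds → defect ⟦ succ ds ⟧ ≡ defect ⟦ ds ⟧ ℤ.+ + isTight (state ds)
      defect-succ [] _ = refl
      defect-succ (d ∷ ds) (adm , d≤cap) with d <? cap (state ds)
      ... | yes d<cap = begin
        defect ⟦ suc d ∷ ds ⟧                            ≡⟨ defect-digit (suc d) (β· ⟦ ds ⟧) ⟩
        rank ⟦ ds ⟧                                      ≡⟨ defect-digit d (β· ⟦ ds ⟧) ⟨
        defect ⟦ d ∷ ds ⟧                                ≡⟨ ℤP.+-identityʳ _ ⟨
        defect ⟦ d ∷ ds ⟧ ℤ.+ + isTight loose            ≡⟨ cong (λ t → defect ⟦ d ∷ ds ⟧ ℤ.+ + isTight t) loose≡ ⟨
        defect ⟦ d ∷ ds ⟧ ℤ.+ + isTight (state (d ∷ ds)) ∎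
        where
        open ≡-Reasoning
        loose≡ : next (state ds) d ≡ loose
        loose≡ = next-≢cap _ d (λ d≡ → ℕP.<-irrefl d≡ d<cap)
      ... | no d≮cap = begin
        defect ⟦ 0 ∷ succ ds ⟧                           ≡⟨ defect-digit 0 (β· ⟦ succ ds ⟧) ⟩
        rank ⟦ succ ds ⟧                                 ≡⟨ rank-succ ds adm ⟩
        rank ⟦ ds ⟧ ℤ.+ 1ℤ
          ≡⟨ cong₂ ℤ._+_ (defect-digit d (β· ⟦ ds ⟧)) (cong (λ t → + isTight t) tight≡) ⟨
        defect ⟦ d ∷ ds ⟧ ℤ.+ + isTight (state (d ∷ ds)) ∎
        where
        open ≡-Reasoning
        tight≡ : next (state ds) d ≡ tight
        tight≡ = next-≡cap _ d (ℕP.≤-antisym d≤cap (ℕP.≮⇒≥ d≮cap))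

    rank-enum : ∀ n → rank ⟦ enum n ⟧ ≡ + n
    rank-enum zero = refl
    rank-enum (suc n) = begin
      rank ⟦ enum (suc n) ⟧   ≡⟨ rank-succ (enum n) (admissible-enum n) ⟩
      rank ⟦ enum n ⟧ ℤ.+ 1ℤ  ≡⟨ cong (ℤ._+ 1ℤ) (rank-enum n) ⟩
      + n ℤ.+ 1ℤ              ≡⟨ ℤP.pos-+ n 1 ⟨
      + (n + 1)               ≡⟨ cong +_ (ℕP.+-comm n 1) ⟩
      + suc n                 ∎
      where open ≡-Reasoning

    defect-enum : ∀ n → defect ⟦ enum n ⟧ ≡ + tights n
    defect-enum zero = refl
    defect-enum (suc n) = begin
      defect ⟦ enum (suc n) ⟧                           ≡⟨ defect-succ (enum n) (admissible-enum n) ⟩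
      defect ⟦ enum n ⟧ ℤ.+ + isTight (enumState n)     ≡⟨ cong (ℤ._+ + isTight (enumState n)) (defect-enum n) ⟩
      + tights n ℤ.+ + isTight (enumState n)            ≡⟨ ℤP.pos-+ (tights n) (isTight (enumState n)) ⟨
      + tights (suc n)                                  ∎
      where open ≡-Reasoning

    admissible-enumerated : ∀ ds → Admissible ds → ∃ λ n → ⟦ ds ⟧ ≡ ⟦ enum n ⟧ × state ds ≡ enumState n
    admissible-enumerated [] _ = 0 , refl , refl
    admissible-enumerated (d ∷ ds) (adm , d≤cap) with admissible-enumerated ds adm
    ... | n , v≡ , s≡ =
      blockStart n + d ,
      trans (cong (λ v → ι (+ d) ⊕ β· v) v≡) (sym (val-enum-inBlock n d d≤cap′)) ,
      trans (cong (λ s → next s d) s≡) (sym (enumState-inBlock n d d≤cap′))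
      where
      d≤cap′ : d ≤ cap (enumState n)
      d≤cap′ = subst (λ s → d ≤ cap s) s≡ d≤cap

    AdmissibleValue : Zβ → Set
    AdmissibleValue z = ∃ λ ds → Admissible ds × ⟦ ds ⟧ ≡ z

    admissibleValue-enum : ∀ {z} → AdmissibleValue z → ∃ λ n → rank z ≡ + n × z ≡ ⟦ enum n ⟧
    admissibleValue-enum (ds , adm , refl) with admissible-enumerated ds adm
    ... | n , v≡ , _ = n , trans (cong rank v≡) (rank-enum n) , v≡

    defect-superadditive : ∀ {x y w} → AdmissibleValue x → AdmissibleValue y → AdmissibleValue w →
                           rank x ≡ rank y ℤ.+ rank w → defect y ℤ.+ defect w ℤ.≤ defect x
    defect-superadditive ax ay aw rank≡
      with admissibleValue-enum ax | admissibleValue-enum ay | admissibleValue-enum aw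
    ... | nx , rx , refl | ny , ry , refl | nw , rw , refl =
      subst₂ ℤ._≤_ (sym (trans (cong₂ ℤ._+_ (defect-enum ny) (defect-enum nw)) (sym (ℤP.pos-+ (tights ny) (tights nw)))))
                   (sym (defect-enum nx))
                   (+≤+ (subst (λ n → tights ny + tights nw ≤ tights n) (sym nx≡ny+nw) (tights-superadditive nw ny)))
      where
      nx≡ny+nw : nx ≡ ny + nw
      nx≡ny+nw = ℤP.+-injective (trans (sym rx) (trans rank≡ (trans (cong₂ ℤ._+_ ry rw) (sym (ℤP.pos-+ ny nw)))))

    -- Cancelling powers of β

    βmul-digit-inversion : ∀ d w z → ι (+ d) ⊕ β· w ≡ β· z → rank w ≡ rank z × + d ≡ (defect w ℤ.- defect z) ℤ.* R
    βmul-digit-inversion d w z e = trans (sym (ℤP.+-identityˡ (rank w))) (cong proj₂ e) , (begin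
      + d                                                   ≡⟨ law₁ (+ d) (defect w ℤ.* R) ⟩
      (+ d ℤ.+ ℤ.- (defect w ℤ.* R)) ℤ.+ defect w ℤ.* R     ≡⟨ cong (ℤ._+ defect w ℤ.* R) (cong proj₁ e) ⟩
      ℤ.- (defect z ℤ.* R) ℤ.+ defect w ℤ.* R               ≡⟨ law₂ (defect z) (defect w) R ⟩
      (defect w ℤ.- defect z) ℤ.* R                         ∎)
      where
      open ≡-Reasoning
      law₁ : ∀ d x → d ≡ (d ℤ.+ ℤ.- x) ℤ.+ x
      law₁ = solve-∀
      law₂ : ∀ z w R → ℤ.- (z ℤ.* R) ℤ.+ w ℤ.* R ≡ (w ℤ.- z) ℤ.* R
      law₂ = solve-∀

    R-multiple-nonpos : ∀ {δ d} → δ ℤ.≤ 0ℤ → + d ≡ δ ℤ.* R → δ ≡ 0ℤ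
    R-multiple-nonpos {+0} _ _ = refl
    R-multiple-nonpos {+[1+ m ]} (+≤+ ()) _
    R-multiple-nonpos { -[1+ m ]} _ e with trans e (cong (-[1+ m ] ℤ.*_) R≡+[1+pred-r])
    ... | ()

    -- superadditivity of the defect forces the lowest digit to vanish
    βmul-digit-cancel : ∀ {x y} d V → AdmissibleValue x → AdmissibleValue y → Admissible V →
                        ι (+ d) ⊕ β· ⟦ V ⟧ ≡ β· (x ⊖ y) → ⟦ V ⟧ ≡ x ⊖ y
    βmul-digit-cancel {x} {y} d V ax ay adm e = rank-defect-injective rank≡ (ℤP.i-j≡0⇒i≡j _ _ δ≡0)
      where
      inversion = βmul-digit-inversion d ⟦ V ⟧ (x ⊖ y) e
      rank≡ = proj₁ inversion
      rank-x : rank x ≡ rank y ℤ.+ rank ⟦ V ⟧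
      rank-x = trans (law₁ (rank x) (rank y)) (cong (λ t → rank y ℤ.+ t) (sym (trans rank≡ (rank-⊖ x y))))
        where
        law₁ : ∀ a b → a ≡ b ℤ.+ (a ℤ.- b)
        law₁ = solve-∀
      defectV≤ : defect ⟦ V ⟧ ℤ.≤ defect x ℤ.- defect y
      defectV≤ = subst (ℤ._≤ defect x ℤ.- defect y) (law₂ (defect y) (defect ⟦ V ⟧))
                   (ℤP.+-monoˡ-≤ (ℤ.- defect y) (defect-superadditive ax ay (V , adm , refl) rank-x))
        where
        law₂ : ∀ a b → (a ℤ.+ b) ℤ.- a ≡ b
        law₂ = solve-∀
      δ≡0 : defect ⟦ V ⟧ ℤ.- defect (x ⊖ y) ≡ 0ℤ
      δ≡0 = R-multiple-nonpos (ℤP.i≤j⇒i-j≤0 defectV≤) (proj₂ inversion)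

    admissibleValue-βmul : ∀ {x} → AdmissibleValue x → AdmissibleValue (β· x)
    admissibleValue-βmul (ds , adm , refl) = 0 ∷ ds , (adm , z≤n) , val-0∷ ds

    βmul-cancel : ∀ {x y} → AdmissibleValue x → AdmissibleValue y →
                  AdmissibleValue (β· (x ⊖ y)) → AdmissibleValue (x ⊖ y)
    βmul-cancel ax ay ([] , _ , e) = [] , tt , βmul-digit-cancel 0 [] ax ay tt e
    βmul-cancel ax ay (d ∷ V , (adm , _) , e) = V , adm , βmul-digit-cancel d V ax ay adm e

    βpowMul-cancel : ∀ n {x y} → AdmissibleValue x → AdmissibleValue y →
                     AdmissibleValue (β^ n · (x ⊖ y)) → AdmissibleValue (x ⊖ y)
    βpowMul-cancel zero ax ay az = az
    βpowMul-cancel (suc n) {x} {y} ax ay (W , adm , e) =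
      βmul-cancel ax ay (subst AdmissibleValue (sym (βmul-⊖ x y))
        (βpowMul-cancel n (admissibleValue-βmul ax) (admissibleValue-βmul ay) (W , adm , e′)))
      where
      e′ : ⟦ W ⟧ ≡ β^ n · (β· x ⊖ β· y)
      e′ = trans e (trans (sym (βpowMul-βmul n (x ⊖ y))) (cong (β^ n ·_) (βmul-⊖ x y)))

    -- Greedy expansions

    Greedy : List ℕ → Set
    Greedy ds = ∀ j → j ≤ length ds → ⟦ take j ds ⟧ <[ p , q ] βpow p q j

    βpow-⊖-val-++ : ∀ pre T n →
                    βpow p q (length pre + n) ⊖ ⟦ pre ++ T ⟧ ≡ ⊝ (⟦ pre ⟧ ⊕ β^ length pre · (⟦ T ⟧ ⊖ βpow p q n))
    βpow-⊖-val-++ pre T n = begin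
      βpow p q (m + n) ⊖ ⟦ pre ++ T ⟧                            ≡⟨ cong₂ _⊖_ (βpow-+ m n) (val-++ pre T) ⟩
      β^ m · βpow p q n ⊖ (⟦ pre ⟧ ⊕ β^ m · ⟦ T ⟧)                ≡⟨ ⊖-⊕-distrib (β^ m · βpow p q n) ⟦ pre ⟧ _ ⟩
      ⊝ (⟦ pre ⟧ ⊕ (β^ m · ⟦ T ⟧ ⊖ β^ m · βpow p q n))           ≡⟨ cong (λ w → ⊝ (⟦ pre ⟧ ⊕ w)) (βpowMul-⊖ m ⟦ T ⟧ _) ⟨
      ⊝ (⟦ pre ⟧ ⊕ β^ m · (⟦ T ⟧ ⊖ βpow p q n))                  ∎
      where
      open ≡-Reasoning
      m = length pre

    βmul-overshoot : ∀ t → β· (ι (+ (suc p + t)) ⊖ β) ≡ cone (r + p * t) t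
    βmul-overshoot t = cong₂ _,_
      (trans (law₁ R) (trans R≡+r (trans (law₂ (+ r) (+ p) (+ t))
        (cong (λ x → x ℤ.- + p ℤ.* + t) (sym (trans (ℤP.pos-+ r (p * t)) (cong (λ x → + r ℤ.+ x) (ℤP.pos-* p t))))))))
      (trans (cong (λ x → (x ℤ.+ ℤ.- 0ℤ) ℤ.+ (0ℤ ℤ.+ ℤ.- 1ℤ) ℤ.* P) (ℤP.pos-+ (suc p) t)) (law₃ P (+ t)))
      where
      law₁ : ∀ R → ℤ.- ((0ℤ ℤ.+ ℤ.- 1ℤ) ℤ.* R) ≡ R
      law₁ = solve-∀
      law₂ : ∀ r p t → r ≡ (r ℤ.+ p ℤ.* t) ℤ.- p ℤ.* t
      law₂ = solve-∀
      law₃ : ∀ P t → ((P ℤ.+ t) ℤ.+ ℤ.- 0ℤ) ℤ.+ (0ℤ ℤ.+ ℤ.- 1ℤ) ℤ.* P ≡ t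
      law₃ = solve-∀

    ¬pos-overshoot : ∀ pre e → suc p ≤ e → ¬ Pos p q (⊝ (⟦ pre ⟧ ⊕ β^ length pre · (ι (+ e) ⊖ β)))
    ¬pos-overshoot [] e p<e = β-below-1+p e p<e ∘ subst (Pos p q ∘ ⊝_) (⊕-identityˡ (ι (+ e) ⊖ β))
    ¬pos-overshoot (d ∷ pre) e p<e with ℕP.m≤n⇒∃[o]m+o≡n p<e
    ... | t , refl = ¬pos-⊝InCone (InCone-⊕ (InCone-val (d ∷ pre))
                       (subst InCone (βpowMul-βmul (length pre) _)
                         (InCone-βpowMul (length pre) (r + p * t , t , βmul-overshoot t))))

    greedy-overshoot : ∀ pre T rest e → Greedy (pre ++ T ++ rest) →
                       ⟦ T ⟧ ⊖ βpow p q (length T) ≡ ι (+ e) ⊖ β → e ≤ p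
    greedy-overshoot pre T rest e greedy deficit≡ = ℕP.≮⇒≥ λ p<e →
      ¬pos-overshoot pre e p<e (subst (Pos p q) deficit-shifted (greedy (m + n) (length-++-prefix pre T rest)))
      where
      open ≡-Reasoning
      m = length pre
      n = length T
      deficit-shifted : βpow p q (m + n) ⊖ ⟦ take (m + n) (pre ++ T ++ rest) ⟧ ≡ ⊝ (⟦ pre ⟧ ⊕ β^ m · (ι (+ e) ⊖ β))
      deficit-shifted = begin
        βpow p q (m + n) ⊖ ⟦ take (m + n) (pre ++ T ++ rest) ⟧
          ≡⟨ cong (λ ds → βpow p q (m + n) ⊖ ⟦ ds ⟧) (take-++-length pre T rest) ⟩
        βpow p q (m + n) ⊖ ⟦ pre ++ T ⟧                        ≡⟨ βpow-⊖-val-++ pre T n ⟩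
        ⊝ (⟦ pre ⟧ ⊕ β^ m · (⟦ T ⟧ ⊖ βpow p q n))              ≡⟨ cong (λ z → ⊝ (⟦ pre ⟧ ⊕ β^ m · z)) deficit≡ ⟩
        ⊝ (⟦ pre ⟧ ⊕ β^ m · (ι (+ e) ⊖ β))                     ∎

    deficit-digit : ∀ d → ⟦ d ∷ [] ⟧ ⊖ βpow p q 1 ≡ ι (+ d) ⊖ β
    deficit-digit d = cong₂ _,_ (cong (ℤ._+ 0ℤ) (ℤP.+-identityʳ (+ d))) refl

    -- β (p − β) = (p − q) − β, as β² = (p + 1) β − (p − q)
    βmul-p⊖β : ∀ d → ι (+ d) ⊕ β· (ι (+ p) ⊖ β) ≡ ι (+ d ℤ.+ R) ⊖ β
    βmul-p⊖β d = cong₂ _,_ (law₁ (+ d) R) (law₂ (+ p))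
      where
      law₁ : ∀ d R → d ℤ.+ ℤ.- ((0ℤ ℤ.+ ℤ.- 1ℤ) ℤ.* R) ≡ (d ℤ.+ R) ℤ.+ ℤ.- 0ℤ
      law₁ = solve-∀
      law₂ : ∀ p → 0ℤ ℤ.+ ((p ℤ.+ ℤ.- 0ℤ) ℤ.+ (0ℤ ℤ.+ ℤ.- 1ℤ) ℤ.* (1ℤ ℤ.+ p)) ≡ 0ℤ ℤ.+ ℤ.- 1ℤ
      law₂ = solve-∀

    deficit-∷ : ∀ d ds → ⟦ ds ⟧ ⊖ βpow p q (length ds) ≡ ι (+ p) ⊖ β →
                ⟦ d ∷ ds ⟧ ⊖ βpow p q (length (d ∷ ds)) ≡ ι (+ (d + r)) ⊖ β
    deficit-∷ d ds deficit≡ = begin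
      (ι (+ d) ⊕ β· ⟦ ds ⟧) ⊖ β· βpow p q n     ≡⟨ ⊕-assoc (ι (+ d)) (β· ⟦ ds ⟧) _ ⟩
      ι (+ d) ⊕ (β· ⟦ ds ⟧ ⊖ β· βpow p q n)     ≡⟨ cong (ι (+ d) ⊕_) (βmul-⊖ ⟦ ds ⟧ (βpow p q n)) ⟨
      ι (+ d) ⊕ β· (⟦ ds ⟧ ⊖ βpow p q n)        ≡⟨ cong (λ z → ι (+ d) ⊕ β· z) deficit≡ ⟩
      ι (+ d) ⊕ β· (ι (+ p) ⊖ β)                ≡⟨ βmul-p⊖β d ⟩
      ι (+ d ℤ.+ R) ⊖ β                         ≡⟨ cong (λ x → ι (+ d ℤ.+ x) ⊖ β) R≡+r ⟩
      ι (+ d ℤ.+ + r) ⊖ β                       ≡⟨ cong (λ x → ι x ⊖ β) (ℤP.pos-+ d r) ⟨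
      ι (+ (d + r)) ⊖ β                         ∎
      where
      open ≡-Reasoning
      n = length ds

    deficit-qᵏp : ∀ k → ⟦ replicate k q ++ p ∷ [] ⟧ ⊖ βpow p q (length (replicate k q ++ p ∷ [])) ≡ ι (+ p) ⊖ β
    deficit-qᵏp zero = deficit-digit p
    deficit-qᵏp (suc k) = trans (deficit-∷ q (replicate k q ++ p ∷ []) (deficit-qᵏp k)) (cong (λ n → ι (+ n) ⊖ β) q+r≡p)

    tight-prefix : ∀ ds → state ds ≡ tight → ∃₂ λ k rest → ds ≡ replicate k q ++ p ∷ rest
    tight-prefix (d ∷ ds) e with state ds in s≡
    ... | loose = 0 , ds , cong (_∷ ds) (next≡tight⇒≡cap loose d e)
    ... | tight with tight-prefix ds s≡
    ...   | k , rest , refl = suc k , rest , cong (_∷ _) (next≡tight⇒≡cap tight d e)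

    -- a digit above the bound would let the truncated expansion exceed the next power of β
    digit-bound : ∀ pre d ds → Greedy (pre ++ d ∷ ds) → d ≤ cap (state ds)
    digit-bound pre d ds greedy with state ds in s≡
    ... | loose = greedy-overshoot pre (d ∷ []) ds d greedy (deficit-digit d)
    ... | tight with tight-prefix ds s≡
    ...   | k , rest , refl = ℕP.+-cancelʳ-≤ r d q (subst (d + r ≤_) (sym q+r≡p)
              (greedy-overshoot pre (d ∷ replicate k q ++ p ∷ []) rest (d + r)
                 (subst (λ xs → Greedy (pre ++ d ∷ xs)) (sym (++-assoc (replicate k q) (p ∷ []) rest)) greedy)
                 (deficit-∷ d (replicate k q ++ p ∷ []) (deficit-qᵏp k))))

    greedy⇒admissible : ∀ pre ds → Greedy (pre ++ ds) → Admissible ds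
    greedy⇒admissible pre [] _ = tt
    greedy⇒admissible pre (d ∷ ds) greedy =
      greedy⇒admissible (pre ++ d ∷ []) ds (subst Greedy (sym (++-assoc pre (d ∷ []) ds)) greedy) ,
      digit-bound pre d ds greedy

    -- s ⊑ s′ : the constraints after s are at least those after s′
    data _⊑_ : State → State → Set where
      tight⊑ : ∀ {s} → tight ⊑ s
      loose⊑loose : loose ⊑ loose

    ⊑-loose : ∀ s → s ⊑ loose
    ⊑-loose loose = loose⊑loose
    ⊑-loose tight = tight⊑

    ⊑-refl : ∀ s → s ⊑ s
    ⊑-refl loose = loose⊑loose
    ⊑-refl tight = tight⊑

    cap-mono : ∀ {s s′} → s ⊑ s′ → cap s ≤ cap s′
    cap-mono {s′ = loose} tight⊑ = ℕP.<⇒≤ q<p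
    cap-mono {s′ = tight} tight⊑ = ℕP.≤-refl
    cap-mono loose⊑loose = ℕP.≤-refl

    next-mono : ∀ {s s′} d → s ⊑ s′ → d ≤ cap s → next s d ⊑ next s′ d
    next-mono {s′ = loose} d tight⊑ d≤q =
      subst (next tight d ⊑_) (sym (next-≢cap loose d (λ d≡p → ℕP.<-irrefl d≡p (ℕP.≤-<-trans d≤q q<p)))) (⊑-loose _)
    next-mono {s′ = tight} d tight⊑ _ = ⊑-refl _
    next-mono d loose⊑loose _ = ⊑-refl _

    admissible-take : ∀ j ds → Admissible ds → Admissible (take j ds) × state ds ⊑ state (take j ds)
    admissible-take zero ds _ = tt , ⊑-loose (state ds)
    admissible-take (suc j) [] _ = tt , loose⊑loose
    admissible-take (suc j) (d ∷ ds) (adm , d≤cap) with admissible-take j ds adm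
    ... | adm′ , s⊑ = (adm′ , ℕP.≤-trans d≤cap (cap-mono s⊑)) , next-mono d s⊑ d≤cap

    -- a lower bound for β^(length ds) − ⟦ ds ⟧ according to the state the automaton ends in
    gap : State → Zβ
    gap loose = cone 1 0
    gap tight = cone 0 1

    βmul-gap : ∀ s → β· gap s ≡ cone (cap s) 1
    βmul-gap loose = trans (βmul-cone 1 0) (cong (λ c → cone c 1) (trans (ℕP.+-identityʳ _) (ℕP.*-identityˡ p)))
    βmul-gap tight = trans (βmul-cone 0 1) (cong (λ c → cone c 1) (ℕP.*-identityˡ q))

    gap-step : ∀ s d → d ≤ cap s → InCone ((β· gap s ⊖ ι (+ d)) ⊖ gap (next s d))
    gap-step s d d≤cap with d ≟ cap s
    ... | yes refl = 0 , 0 , trans (cong (λ v → (v ⊖ ι (+ cap s)) ⊖ cone 0 1) (βmul-gap s)) (cone-cap (cap s))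
      where
      cone-cap : ∀ c → (cone c 1 ⊖ ι (+ c)) ⊖ cone 0 1 ≡ cone 0 0
      cone-cap c = cong₂ _,_ (law (+ c) (+ p)) refl
        where
        law : ∀ c p → ((c ℤ.- p ℤ.* + 1) ℤ.+ ℤ.- c) ℤ.+ ℤ.- (+ 0 ℤ.- p ℤ.* + 1) ≡ + 0 ℤ.- p ℤ.* + 0
        law = solve-∀
    ... | no d≢cap with ℕP.m≤n⇒∃[o]m+o≡n (ℕP.≤∧≢⇒< d≤cap d≢cap)
    ...   | w , d+1+w≡cap = w , 1 , trans (cong (λ v → (v ⊖ ι (+ d)) ⊖ cone 1 0) (trans (βmul-gap s) cap≡)) (cone-digit d w)
      where
      cap≡ : cone (cap s) 1 ≡ cone (d + suc w) 1
      cap≡ = cong (λ c → cone c 1) (sym (trans (ℕP.+-suc d w) d+1+w≡cap))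
      cone-digit : ∀ d w → (cone (d + suc w) 1 ⊖ ι (+ d)) ⊖ cone 1 0 ≡ cone w 1
      cone-digit d w = cong₂ _,_ (trans (cong (λ x → ((x ℤ.- + p ℤ.* + 1) ℤ.+ ℤ.- + d) ℤ.+ ℤ.- (+ 1 ℤ.- + p ℤ.* + 0))
                                                 (trans (ℤP.pos-+ d (suc w)) (cong (λ y → + d ℤ.+ y) (ℤP.pos-+ 1 w))))
                                        (law (+ d) (+ w) (+ p)))
                                 refl
        where
        law : ∀ d w p → (((d ℤ.+ (+ 1 ℤ.+ w)) ℤ.- p ℤ.* + 1) ℤ.+ ℤ.- d) ℤ.+ ℤ.- (+ 1 ℤ.- p ℤ.* + 0) ≡ w ℤ.- p ℤ.* + 1
        law = solve-∀

    deficit-split : ∀ B V G G′ d → (β· B ⊖ (ι (+ d) ⊕ β· V)) ⊖ G′ ≡ β· ((B ⊖ V) ⊖ G) ⊕ ((β· G ⊖ ι (+ d)) ⊖ G′)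
    deficit-split (a₁ , b₁) (a₂ , b₂) (a₃ , b₃) (a₄ , b₄) d =
      cong₂ _,_ (law₁ b₁ b₂ b₃ a₄ (+ d) R) (law₂ a₁ b₁ a₂ b₂ a₃ b₃ b₄ P)
      where
      law₁ : ∀ b₁ b₂ b₃ a₄ d R →
             (ℤ.- (b₁ ℤ.* R) ℤ.+ ℤ.- (d ℤ.+ ℤ.- (b₂ ℤ.* R))) ℤ.+ ℤ.- a₄
             ≡ ℤ.- (((b₁ ℤ.+ ℤ.- b₂) ℤ.+ ℤ.- b₃) ℤ.* R) ℤ.+ ((ℤ.- (b₃ ℤ.* R) ℤ.+ ℤ.- d) ℤ.+ ℤ.- a₄)
      law₁ = solve-∀
      law₂ : ∀ a₁ b₁ a₂ b₂ a₃ b₃ b₄ P →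
             ((a₁ ℤ.+ b₁ ℤ.* P) ℤ.+ ℤ.- (0ℤ ℤ.+ (a₂ ℤ.+ b₂ ℤ.* P))) ℤ.+ ℤ.- b₄
             ≡ (((a₁ ℤ.+ ℤ.- a₂) ℤ.+ ℤ.- a₃) ℤ.+ ((b₁ ℤ.+ ℤ.- b₂) ℤ.+ ℤ.- b₃) ℤ.* P)
               ℤ.+ (((a₃ ℤ.+ b₃ ℤ.* P) ℤ.+ ℤ.- 0ℤ) ℤ.+ ℤ.- b₄)
      law₂ = solve-∀

    deficit-cone : ∀ ds → Admissible ds → InCone ((βpow p q (length ds) ⊖ ⟦ ds ⟧) ⊖ gap (state ds))
    deficit-cone [] _ = 0 , 0 , cong₂ _,_ (law (+ p)) refl
      where
      law : ∀ p → (1ℤ ℤ.+ ℤ.- 0ℤ) ℤ.+ ℤ.- (+ 1 ℤ.- p ℤ.* + 0) ≡ + 0 ℤ.- p ℤ.* + 0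
      law = solve-∀
    deficit-cone (d ∷ ds) (adm , d≤cap) =
      subst InCone (sym (deficit-split (βpow p q (length ds)) ⟦ ds ⟧ (gap (state ds)) (gap (state (d ∷ ds))) d))
        (InCone-⊕ (InCone-βmul (deficit-cone ds adm)) (gap-step (state ds) d d≤cap))

    pos-⊕gap : ∀ {z} s → InCone z → Pos p q (z ⊕ gap s)
    pos-⊕gap loose (s , t , refl) = subst (Pos p q) (sym (cone-⊕ s t 1 0))
      (cone-pos (s + 1) (t + 0) (ℕP.≤-trans (ℕP.m≤n+m 1 s) (ℕP.m≤m+n (s + 1) (t + 0))))
    pos-⊕gap tight (s , t , refl) = subst (Pos p q) (sym (cone-⊕ s t 0 1))
      (cone-pos (s + 0) (t + 1) (ℕP.≤-trans (ℕP.m≤n+m 1 t) (ℕP.m≤n+m (t + 1) (s + 0))))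

    admissible⇒greedy : ∀ ds → Admissible ds → Greedy ds
    admissible⇒greedy ds adm j j≤len =
      subst (Pos p q) (sym deficit≡) (pos-⊕gap (state T) (subst InCone (cong (λ n → (βpow p q n ⊖ ⟦ T ⟧) ⊖ gap (state T)) length-T)
                                                                 (deficit-cone T (proj₁ (admissible-take j ds adm)))))
      where
      T = take j ds
      length-T : length T ≡ j
      length-T = trans (length-take j ds) (ℕP.m≤n⇒m⊓n≡m j≤len)
      deficit≡ : βpow p q j ⊖ ⟦ T ⟧ ≡ ((βpow p q j ⊖ ⟦ T ⟧) ⊖ gap (state T)) ⊕ gap (state T)
      deficit≡ = sym (⊖-⊕-cancel _ (gap (state T)))

    -- Membership in ℤβ and Fin(β)

    LastNonzero : List ℕ → Set
    LastNonzero ds = ∃₂ λ init d → ds ≡ init ∷ʳ d × d ≢ 0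

    lastNonzero-∷ : ∀ d {ds} → LastNonzero ds → LastNonzero (d ∷ ds)
    lastNonzero-∷ d (init , e , refl , e≢0) = d ∷ init , e , refl , e≢0

    lastNonzero-tail : ∀ d ds → LastNonzero (d ∷ ds) → ds ≡ [] ⊎ LastNonzero ds
    lastNonzero-tail d ds ([] , e , eq , _) = inj₁ (∷-injectiveʳ eq)
    lastNonzero-tail d ds (_ ∷ init , e , eq , e≢0) = inj₂ (init , e , ∷-injectiveʳ eq , e≢0)

    succ-lastNonzero : ∀ ds → ds ≡ [] ⊎ LastNonzero ds → LastNonzero (succ ds)
    succ-lastNonzero [] _ = [] , 1 , refl , λ ()
    succ-lastNonzero (d ∷ ds) (inj₂ last) with d <? cap (state ds) | lastNonzero-tail d ds last
    ... | yes _ | inj₁ refl = [] , suc d , refl , λ ()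
    ... | yes _ | inj₂ last′ = lastNonzero-∷ (suc d) last′
    ... | no _  | tail = lastNonzero-∷ 0 (succ-lastNonzero ds tail)

    enum-lastNonzero : ∀ n → LastNonzero (enum (suc n))
    enum-lastNonzero zero = succ-lastNonzero [] (inj₁ refl)
    enum-lastNonzero (suc n) = succ-lastNonzero (enum (suc n)) (inj₂ (enum-lastNonzero n))

    admissibleValue⇒Inℤβ : ∀ {z} → AdmissibleValue z → Inℤβ p q z
    admissibleValue⇒Inℤβ az with admissibleValue-enum az
    ... | zero , _ , refl = inj₁ refl
    ... | suc n , rank≡ , refl = inj₂ (inj₁ (pos-InCone (InCone-val (enum (suc n))) rank≡ ,
                                             enum (suc n) , refl , enum-lastNonzero n ,
                                             admissible⇒greedy (enum (suc n)) (admissible-enum (suc n))))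

    -- an admissible value is determined by its rank, which makes membership decidable
    admissibleValue? : ∀ z → Dec (AdmissibleValue z)
    admissibleValue? z with rank z in rank≡
    ... | -[1+ k ] = no λ az → nonneg≢neg (trans (sym (proj₁ (proj₂ (admissibleValue-enum az)))) rank≡)
      where
      nonneg≢neg : ∀ {n} → + n ≢ -[1+ k ]
      nonneg≢neg ()
    ... | + n with ≡-dec ℤ._≟_ ℤ._≟_ ⟦ enum n ⟧ z
    ...   | yes e = yes (enum n , admissible-enum n , e)
    ...   | no ne = no λ az → let (m , rank≡′ , z≡) = admissibleValue-enum az in
                      ne (trans (cong (⟦_⟧ ∘ enum) (ℤP.+-injective (trans (sym rank≡) rank≡′))) (sym z≡))

    Inℤβ⇒admissibleValue : ∀ {z w} → Inℤβ p q z → AdmissibleValue w → Pos p q (z ⊖ w) → AdmissibleValue z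
    Inℤβ⇒admissibleValue (inj₁ z≡𝟘) _ _ = [] , tt , sym z≡𝟘
    Inℤβ⇒admissibleValue (inj₂ (inj₁ (_ , ds , v≡ , _ , greedy))) _ _ = ds , greedy⇒admissible [] ds greedy , v≡
    Inℤβ⇒admissibleValue {z} (inj₂ (inj₂ (_ , ds , v≡ , _ , _))) (W , _ , refl) pos =
      ⊥-elim (¬pos-⊝InCone (InCone-⊕ (InCone-val ds) (InCone-val W)) (subst (Pos p q) z⊖W≡ pos))
      where
      z⊖W≡ : z ⊖ ⟦ W ⟧ ≡ ⊝ (⟦ ds ⟧ ⊕ ⟦ W ⟧)
      z⊖W≡ = trans (cong (_⊖ ⟦ W ⟧) (trans (sym (⊝-involutive z)) (cong ⊝_ (sym v≡)))) (⊝-⊕ ⟦ ds ⟧ ⟦ W ⟧)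

    nonneg-Inℤβ⇒admissibleValue : ∀ {z} → Inℤβ p q z → 𝟘 ≤[ p , q ] z → AdmissibleValue z
    nonneg-Inℤβ⇒admissibleValue _ (inj₂ 𝟘≡z) = [] , tt , 𝟘≡z
    nonneg-Inℤβ⇒admissibleValue z∈ℤβ (inj₁ pos) = Inℤβ⇒admissibleValue z∈ℤβ ([] , tt , refl) pos

    InFin⇒admissibleValue : ∀ {x y} → AdmissibleValue x → AdmissibleValue y → Pos p q (x ⊖ y) →
                            InFin p q (x ⊖ y) → AdmissibleValue (x ⊖ y)
    InFin⇒admissibleValue ax ay _ (n , inj₁ z≡𝟘) = βpowMul-cancel n ax ay ([] , tt , sym z≡𝟘)
    InFin⇒admissibleValue ax ay _ (n , inj₂ (inj₁ (_ , ds , v≡ , _ , greedy))) =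
      βpowMul-cancel n ax ay (ds , greedy⇒admissible [] ds greedy , v≡)
    InFin⇒admissibleValue {x} {y} ax ay pos (n , inj₂ (inj₂ (_ , ds , v≡ , _ , greedy))) =
      ⊥-elim (¬pos-⊝InCone (InCone-val W) (subst (Pos p q) x⊖y≡ pos))
      where
      v≡′ : ⟦ ds ⟧ ≡ β^ n · (y ⊖ x)
      v≡′ = trans v≡ (trans (sym (βpowMul-⊝ n (x ⊖ y))) (cong (β^ n ·_) (⊝-⊖ x y)))
      ay-x = βpowMul-cancel n ay ax (ds , greedy⇒admissible [] ds greedy , v≡′)
      W = proj₁ ay-x
      x⊖y≡ : x ⊖ y ≡ ⊝ ⟦ W ⟧
      x⊖y≡ = trans (sym (⊝-⊖ y x)) (cong ⊝_ (sym (proj₂ (proj₂ ay-x))))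

mainTheorem12 : (p q : ℕ) → 1 ≤ q → q < p →
    (x y : Zβ) → Inℤβ p q x → Inℤβ p q y →
    y ≤[ p , q ] x → 𝟘 ≤[ p , q ] y →
    Inℤβ p q (x ⊖ y) ⊎ ¬ InFin p q (x ⊖ y)
mainTheorem12 p q 1≤q q<p x .x _ _ (inj₂ refl) _ = inj₁ (inj₁ (⊖-self x))
mainTheorem12 p q 1≤q q<p x y x∈ℤβ y∈ℤβ (inj₁ y<x) 0≤y =
  Sum.map admissibleValue⇒Inℤβ (_∘ InFin⇒admissibleValue ax ay y<x) (toSum (admissibleValue? (x ⊖ y)))
  where
  open Expansion p q
  open Bounded 1≤q q<p
  ay : AdmissibleValue y
  ay = nonneg-Inℤβ⇒admissibleValue y∈ℤβ 0≤y
  ax : AdmissibleValue x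
  ax = Inℤβ⇒admissibleValue x∈ℤβ ay y<x
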